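{- Let $\mathbf k=(k_1,\dots,k_d)\in\mathbb Z_{\ge0}^d$ ($d\ge0$) and $A=A(\mathbf k)=v_{k_1}\cdots v_{k_d}$. Then $A\triangleright_a v_0=(A\mid\mathbf1)\,v_0$, and for $s\ge1$ \[ A\triangleright_a v_s=\sum_{\mathbf l\in\mathbb Z_{\ge0}^d}\mathrm m_{\mathbf k,\mathbf l}\sum_{I\subseteq\{1,\dots,d\}}S(v_{\mathbf l_I})\,v_{s+|\mathbf k|-|\mathbf l|}\,v_{\mathbf l_{I^c}}, \] where for $I=\{i_1<\dots<i_r\}$ we write $v_{\mathbf l_I}=v_{l_{i_1}}\cdots v_{l_{i_r}}$ and $I^c$ is the complement of $I$.
   Context: $V=\{v_0,v_1,\dots\}$; $\mathbb Q\langle V\rangle$ free associative algebra, identified with $U(\mathrm{Lie}(V))$, with shuffle coproduct $\Delta$ (letters primitive, Sweedler notation $A_{(1)}\otimes A_{(2)}$) and antipode $S(a_1\cdots a_n)=(-1)^na_n\cdots a_1$; $(A\mid\mathbf1)$ is the constant term. Ari multiplicity: $\mathrm m_{\mathbf k,\mathbf l}=(-1)^{|\mathbf k|+|\mathbf l|}\prod_i\binom{k_i-1}{l_i-1}$ with $\binom{ -1}{ -1}=1$, $\binom{k-1}{ -1}=\binom{ -1}{l-1}=0$ for $k,l>0$, usual binomials otherwise, and $\mathrm m_{\emptyset,\emptyset}=1$. The post-Lie product $\triangleright_a$ on $\mathrm{Lie}(V)$: on the free magma $M(V)$ (product $\star$), for a bracketing $t(\mathbf k)$ of letters $v_{k_1},\dots,v_{k_d}$,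 $t(\mathbf k)\triangleright_a v_0=0$ and $t(\mathbf k)\triangleright_a v_s=\sum_{\mathbf l}\mathrm m_{\mathbf k,\mathbf l}v_{s+|\mathbf k|-|\mathbf l|}\star t(\mathbf l)$ for $s\ge1$ ($t(\mathbf l)$ = same bracketing with letters $v_{l_i}$), extended linearly in $t$ and as a derivation in the second argument; this descends via $a\star b\mapsto[a,b]$ to a post-Lie product $\triangleright_a$ on the free Lie algebra $\mathrm{Lie}(V)$. It is extended to $\mathbb Q\langle V\rangle^{\otimes2}\to\mathbb Q\langle V\rangle$ by $x\triangleright\mathbf1=0$, $\mathbf1\triangleright A=A$, $xA\triangleright y=x\triangleright(A\triangleright y)-(x\triangleright A)\triangleright y$, $A\triangleright BC=(A_{(1)}\triangleright B)(A_{(2)}\triangleright C)$ for $x,y\in\mathrm{Lie}(V)$. -}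

module Defs where

open import Data.Nat as ℕ using (ℕ; zero; suc; _∸_)
open import Data.Nat.Combinatorics using (_C_)
open import Data.Integer using (+_)
open import Data.Rational as ℚ using (ℚ; 0ℚ; 1ℚ; -_; _/_)
open import Data.List as L using (List; []; _∷_; _++_; map; concatMap; reverse; length; upTo)
open import Data.Nat.ListAction using (sum)
open import Data.List.Properties using (≡-dec)
open import Data.Product using (_×_; _,_)
open import Data.Vec as V using (Vec; []; _∷_; _[_]%=_)
open import Data.Fin using (Fin)
open import Data.List using (allFin)
open import Relation.Binary.PropositionalEquality using (_≡_)
open import Relation.Nullary using (yes; no)

ℕtoℚ : ℕ → ℚ
ℕtoℚ n = (+ n) / 1

sgn : ℕ → ℚ
sgn zero    = 1ℚ
sgn (suc n) = - sgn n

-- Q<V>, V = {v_0, v_1, ...}: a word v_{a_1}...v_{a_n} is the list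
-- [a_1,...,a_n]; a polynomial is a finite formal Q-linear combination
-- of words (list of (coefficient, word)), compared by coefficients.

Word : Set
Word = List ℕ

Poly : Set
Poly = List (ℚ × Word)

coeff : Poly → Word → ℚ
coeff [] w = 0ℚ
coeff ((c , u) ∷ p) w with ≡-dec ℕ._≟_ u w
... | yes _ = c ℚ.+ coeff p w
... | no  _ = coeff p w

_≈ₚ_ : Poly → Poly → Set
p ≈ₚ q = ∀ w → coeff p w ≡ coeff q w

infix 4 _≈ₚ_

wordP : Word → Poly
wordP w = (1ℚ , w) ∷ []

letterP : ℕ → Poly
letterP k = wordP (k ∷ [])

scaleP : ℚ → Poly → Poly
scaleP a = map (λ { (c , w) → (a ℚ.* c , w) })

_+ₚ_ : Poly → Poly → Poly
_+ₚ_ = _++_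

_*ₚ_ : Poly → Poly → Poly
p *ₚ q = concatMap (λ { (c , u) → map (λ { (e , w) → (c ℚ.* e , u ++ w) }) q }) p

sumP : List Poly → Poly
sumP = L.foldr _+ₚ_ []

antipode : Poly → Poly
antipode = map (λ { (c , w) → (sgn (length w) ℚ.* c , reverse w) })

constTerm : Poly → ℚ
constTerm p = coeff p []

-- binom(k-1, l-1) with the conventions binom(-1,-1)=1,
-- binom(k-1,-1)=binom(-1,l-1)=0 for k,l>0
binom₋₁ : ℕ → ℕ → ℚ
binom₋₁ zero    zero    = 1ℚ
binom₋₁ zero    (suc l) = 0ℚ
binom₋₁ (suc k) zero    = 0ℚ
binom₋₁ (suc k) (suc l) = ℕtoℚ (k C l)

prodBinom : List ℕ → List ℕ → ℚ
prodBinom []       []       = 1ℚ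
prodBinom (k ∷ ks) (l ∷ ls) = binom₋₁ k l ℚ.* prodBinom ks ls
prodBinom _        _        = 0ℚ   -- lengths differ (never used)

mult : List ℕ → List ℕ → ℚ
mult k l = sgn (sum k ℕ.+ sum l) ℚ.* prodBinom k l

-- all l with length l = length k and l_i ≤ k_i; outside this box
-- m_{k,l} = 0, so sums over Z_{≥0}^d reduce to sums over box k
box : List ℕ → List (List ℕ)
box []       = [] ∷ []
box (k ∷ ks) = concatMap (λ l → map (l ∷_) (box ks)) (upTo (suc k))

-- all subsets I ⊆ {1..d} of positions of a list l of length d,
-- returned as the pair (l_I , l_{I^c}) (order of entries preserved)
splits : List ℕ → List (List ℕ × List ℕ)
splits []       = ([] , []) ∷ []
splits (x ∷ xs) = concatMap (λ { (a , b) → (x ∷ a , b) ∷ (a , x ∷ b) ∷ [] }) (splits xs)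

-- Free magma M(V) and Lie(V) (as linear combinations of magma
-- elements, with a ⋆ b ↦ [a,b])

data Tree : Set where
  leaf : ℕ → Tree
  _⋆_  : Tree → Tree → Tree

leaves : Tree → List ℕ
leaves (leaf k) = k ∷ []
leaves (t ⋆ u)  = leaves t ++ leaves u

relabel′ : Tree → List ℕ → Tree × List ℕ
relabel′ (leaf k) []       = leaf k , []
relabel′ (leaf k) (l ∷ ls) = leaf l , ls
relabel′ (t ⋆ u)  ls with relabel′ t ls
... | t′ , ls′ with relabel′ u ls′
... | u′ , ls″ = (t′ ⋆ u′) , ls″

relabel : Tree → List ℕ → Tree
relabel t ls with relabel′ t ls
... | t′ , _ = t′

LieC : Set
LieC = List (ℚ × Tree)

scaleL : ℚ → LieC → LieC
scaleL a = map (λ { (c , t) → (a ℚ.* c , t) })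

sumL : List LieC → LieC
sumL = L.foldr _++_ []

treeP : Tree → Poly
treeP (leaf k) = letterP k
treeP (t ⋆ u)  = (treeP t *ₚ treeP u) +ₚ scaleP (- 1ℚ) (treeP u *ₚ treeP t)

lieP : LieC → Poly
lieP x = sumP (map (λ { (c , t) → scaleP c (treeP t) }) x)

_▷t_ : Tree → Tree → LieC
t ▷t leaf zero    = []
t ▷t leaf (suc s) =
  map (λ l → (mult (leaves t) l ,
              leaf (suc s ℕ.+ sum (leaves t) ∸ sum l) ⋆ relabel t l))
      (box (leaves t))
t ▷t (u ⋆ w) =
  map (λ { (c , u′) → (c , u′ ⋆ w) }) (t ▷t u) ++
  map (λ { (c , w′) → (c , u ⋆ w′) }) (t ▷t w)

_▷L_ : LieC → LieC → LieC
x ▷L y = concatMap (λ { (c , t) →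
           concatMap (λ { (e , u) → scaleL (c ℚ.* e) (t ▷t u) }) y }) x

-- Extension of ▷_a to Q<V> ⊗ Lie(V) → Lie(V): the first argument is
-- a product x_1 x_2 ... x_n of Lie elements (a vector of them):
--   1 ▷ y = y,
--   x A ▷ y = x ▷ (A ▷ y) - (x ▷ A) ▷ y,
-- where, x being primitive, x ▷ (x_2 ... x_n) = Σ_i x_2...(x ▷ x_i)...x_n
-- (from A ▷ BC = (A_(1) ▷ B)(A_(2) ▷ C)).

actU : (n : ℕ) → Vec LieC n → LieC → LieC
actU zero    []      y = y
actU (suc n) (x ∷ A) y =
  (x ▷L actU n A y) ++
  scaleL (- 1ℚ) (sumL (map (λ i → actU n (A [ i ]%= (x ▷L_)) y) (allFin n)))

lettersV : (k : List ℕ) → Vec LieC (length k)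
lettersV []       = []
lettersV (k ∷ ks) = ((1ℚ , leaf k) ∷ []) ∷ lettersV ks

actWord : List ℕ → ℕ → Poly
actWord k s = lieP (actU (length k) (lettersV k) ((1ℚ , leaf s) ∷ []))

rhs : List ℕ → ℕ → Poly
rhs k s = sumP (map (λ l → scaleP (mult k l)
            (sumP (map (λ { (lI , lIc) →
               (antipode (wordP lI) *ₚ letterP (s ℕ.+ sum k ∸ sum l)) *ₚ wordP lIc })
             (splits l))))
          (box k))

-- Polynomials are compared through their pairings with arbitrary functionals G on words (pair, ∼⇒≈),
-- so every identity below is an identity between finite rational sums, proved pointwise in G.
--
-- For s ≥ 1 we show A(k) ▷ v_s = Φ, with Φ = Σ_l m_{k,l} R_l(v_{s+|k|-|l|}) and R_l the right-nested
-- bracketing [...[V, v_{l₁}], ..., v_{l_d}], by induction on the factors of A through the recursion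
-- x A ▷ y = x ▷ (A ▷ y) − (x ▷ A) ▷ y. On Q⟨V⟩, x ▷ _ is the derivation D x with
-- D x v_a = Σ m_{k,l} [v_{a+|k|-|l|}, v_l] (sum over the words k of x). The induction step needs two facts:
-- each D x v_a is again a Lie element (by the Jacobi identity), and the multiplicity map
-- Θ : v_k ↦ Σ_l m_{k,l} (|k| - |l|, v_l) is multiplicative and commutes with D x. The latter reduces to
-- a composition law for the multiplicities, which is Pascal's rule for binom(k-1, l-1) in disguise.
-- Finally R_l(V) = Σ_I S(v_{l_I}) V v_{l_{I^c}} by induction on l. For s = 0, every x ▷ _ kills v₀,
-- so only the empty word A = 1 contributes.

module Submission where

open import Defs
open import Data.Nat as ℕ using (ℕ; zero; suc; _∸_; _≤_; _<_; _≥_; z≤n; s≤s)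
import Data.Nat.Properties as NP
open import Data.Nat.Combinatorics using (_C_; k>n⇒nCk≡0; nCk≡nC[n∸k]; nCn≡1; nCk+nC[k+1]≡[n+1]C[k+1])
open import Data.Nat.ListAction using (sum)
open import Data.Nat.ListAction.Properties using (sum-++)
import Data.Integer as ℤ
import Data.Integer.Properties as ZP
open import Data.Rational as ℚ using (ℚ; 0ℚ; 1ℚ; _+_; _*_; -_)
open import Data.Rational.Properties
import Data.Rational.Unnormalised as U
import Data.Rational.Unnormalised.Properties as UP
open import Data.Rational.Solver
open +-*-Solver
open import Data.List using (List; []; _∷_; _++_; map; concatMap; length; reverse; upTo; applyUpTo; allFin; tabulate)
open import Data.List.Properties using (≡-dec; ++-assoc; ++-identityʳ; unfold-reverse)
open import Data.Product using (_×_; _,_; proj₁; proj₂; Σ)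
open import Data.Vec using (Vec; []; _∷_; _[_]%=_)
open import Data.Fin using (Fin; zero; suc)
open import Function using (_∘_)
open import Relation.Binary.PropositionalEquality
open import Relation.Nullary using (yes; no)
open import Algebra.Properties.CommutativeSemigroup NP.+-commutativeSemigroup using () renaming (interchange to ℕ-interchange)

[m+n]∸[o+p]≡[m∸o]+[n∸p] : ∀ {m n o p} → o ≤ m → p ≤ n → (m ℕ.+ n) ∸ (o ℕ.+ p) ≡ (m ∸ o) ℕ.+ (n ∸ p)
[m+n]∸[o+p]≡[m∸o]+[n∸p] {m} {n} {o} {p} o≤m p≤n = begin
    (m ℕ.+ n) ∸ (o ℕ.+ p)    ≡⟨ NP.∸-+-assoc (m ℕ.+ n) o p ⟨
    (m ℕ.+ n) ∸ o ∸ p        ≡⟨ cong (_∸ p) (NP.+-∸-comm n o≤m) ⟩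
    ((m ∸ o) ℕ.+ n) ∸ p      ≡⟨ NP.+-∸-assoc (m ∸ o) p≤n ⟩
    (m ∸ o) ℕ.+ (n ∸ p)      ∎
  where open ≡-Reasoning

[m+o]∸[n+o]≡m∸n : ∀ m n o → (m ℕ.+ o) ∸ (n ℕ.+ o) ≡ m ∸ n
[m+o]∸[n+o]≡m∸n m n o = trans (cong₂ _∸_ (NP.+-comm m o) (NP.+-comm n o)) (NP.[m+n]∸[m+o]≡n∸o o m n)

[[m+[n∸o]]∸p]+[o∸q]≡[m+n]∸[p+q] : ∀ {m n o p q} → p ≤ m ℕ.+ (n ∸ o) → q ≤ o → o ≤ n →
  ((m ℕ.+ (n ∸ o)) ∸ p) ℕ.+ (o ∸ q) ≡ (m ℕ.+ n) ∸ (p ℕ.+ q)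
[[m+[n∸o]]∸p]+[o∸q]≡[m+n]∸[p+q] {m} {n} {o} {p} {q} p≤ q≤o o≤n = sym (begin
    (m ℕ.+ n) ∸ (p ℕ.+ q)                   ≡⟨ cong (λ x → (m ℕ.+ x) ∸ (p ℕ.+ q)) (NP.m∸n+n≡m o≤n) ⟨
    (m ℕ.+ ((n ∸ o) ℕ.+ o)) ∸ (p ℕ.+ q)     ≡⟨ cong (_∸ (p ℕ.+ q)) (NP.+-assoc m (n ∸ o) o) ⟨
    ((m ℕ.+ (n ∸ o)) ℕ.+ o) ∸ (p ℕ.+ q)     ≡⟨ [m+n]∸[o+p]≡[m∸o]+[n∸p] p≤ q≤o ⟩
    ((m ℕ.+ (n ∸ o)) ∸ p) ℕ.+ (o ∸ q)       ∎)
  where open ≡-Reasoning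

[m+n]∸[[o+[n∸p]]+p]≡m∸o : ∀ m {n p} o → p ≤ n → (m ℕ.+ n) ∸ ((o ℕ.+ (n ∸ p)) ℕ.+ p) ≡ m ∸ o
[m+n]∸[[o+[n∸p]]+p]≡m∸o m {n} {p} o p≤n =
  trans (cong ((m ℕ.+ n) ∸_) (trans (NP.+-assoc o (n ∸ p) p) (cong (o ℕ.+_) (NP.m∸n+n≡m p≤n))))
        ([m+o]∸[n+o]≡m∸n m o n)

-- Pairing formal linear combinations with functionals

private variable I I′ : Set

pair : List (ℚ × I) → (I → ℚ) → ℚ
pair [] G = 0ℚ
pair ((c , a) ∷ p) G = c * G a + pair p G

_∼_ : List (ℚ × I) → List (ℚ × I) → Set
p ∼ q = ∀ G → pair p G ≡ pair q G
infix 4 _∼_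

pair-++ : (p q : List (ℚ × I)) (G : I → ℚ) → pair (p ++ q) G ≡ pair p G + pair q G
pair-++ [] q G = sym (+-identityˡ _)
pair-++ ((c , a) ∷ p) q G = trans (cong (c * G a +_) (pair-++ p q G)) (sym (+-assoc (c * G a) (pair p G) (pair q G)))

pair-ext : (p : List (ℚ × I)) {G H : I → ℚ} → (∀ a → G a ≡ H a) → pair p G ≡ pair p H
pair-ext [] e = refl
pair-ext ((c , a) ∷ p) e = cong₂ (λ x y → c * x + y) (e a) (pair-ext p e)

pair-add : (p : List (ℚ × I)) (G H : I → ℚ) → pair p (λ a → G a + H a) ≡ pair p G + pair p H
pair-add [] G H = refl
pair-add ((c , a) ∷ p) G H rewrite pair-add p G H =
  solve 5 (λ c g h x y → c :* (g :+ h) :+ (x :+ y) := (c :* g :+ x) :+ (c :* h :+ y)) refl c (G a) (H a) (pair p G) (pair p H)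

pair-scal : (p : List (ℚ × I)) (k : ℚ) (G : I → ℚ) → pair p (λ a → k * G a) ≡ k * pair p G
pair-scal [] k G = sym (*-zeroʳ k)
pair-scal ((c , a) ∷ p) k G rewrite pair-scal p k G =
  solve 4 (λ c k g x → c :* (k :* g) :+ k :* x := k :* (c :* g :+ x)) refl c k (G a) (pair p G)

pair-zero : (p : List (ℚ × I)) → pair p (λ _ → 0ℚ) ≡ 0ℚ
pair-zero [] = refl
pair-zero ((c , a) ∷ p) rewrite pair-zero p = solve 1 (λ c → c :* con 0ℚ :+ con 0ℚ := con 0ℚ) refl c

pair-neg : (p : List (ℚ × I)) (G : I → ℚ) → pair p (λ a → - G a) ≡ - pair p G
pair-neg [] G = refl
pair-neg ((c , a) ∷ p) G rewrite pair-neg p G =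
  solve 3 (λ c g x → c :* (:- g) :+ :- x := :- (c :* g :+ x)) refl c (G a) (pair p G)

pair-sub : (p : List (ℚ × I)) (G H : I → ℚ) → pair p (λ a → G a + - H a) ≡ pair p G + - pair p H
pair-sub p G H = trans (pair-add p G (λ a → - H a)) (cong (pair p G +_) (pair-neg p H))

pair-swap : (p : List (ℚ × I)) (q : List (ℚ × I′)) (F : I → I′ → ℚ) →
  pair p (λ a → pair q (λ b → F a b)) ≡ pair q (λ b → pair p (λ a → F a b))
pair-swap [] q F = sym (pair-zero q)
pair-swap ((c , a) ∷ p) q F = begin
    c * pair q (F a) + pair p (λ a → pair q (F a))
  ≡⟨ cong₂ _+_ (sym (pair-scal q c (F a))) (pair-swap p q F) ⟩
    pair q (λ b → c * F a b) + pair q (λ b → pair p (λ a → F a b))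
  ≡⟨ sym (pair-add q _ _) ⟩
    pair q (λ b → c * F a b + pair p (λ a → F a b)) ∎
  where open ≡-Reasoning

∑ : {X : Set} → List X → (X → ℚ) → ℚ
∑ [] f = 0ℚ
∑ (x ∷ xs) f = f x + ∑ xs f

pair-concatMap : {X : Set} (h : X → List (ℚ × I)) (xs : List X) (G : I → ℚ) →
  pair (concatMap h xs) G ≡ ∑ xs (λ x → pair (h x) G)
pair-concatMap h [] G = refl
pair-concatMap h (x ∷ xs) G = trans (pair-++ (h x) (concatMap h xs) G) (cong (pair (h x) G +_) (pair-concatMap h xs G))

pair-map : {X : Set} (h : X → ℚ × I) (xs : List X) (G : I → ℚ) →
  pair (map h xs) G ≡ ∑ xs (λ x → proj₁ (h x) * G (proj₂ (h x)))
pair-map h [] G = refl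
pair-map h (x ∷ xs) G = cong (proj₁ (h x) * G (proj₂ (h x)) +_) (pair-map h xs G)

pair≡∑ : (p : List (ℚ × I)) (G : I → ℚ) → pair p G ≡ ∑ p (λ x → proj₁ x * G (proj₂ x))
pair≡∑ [] G = refl
pair≡∑ (x ∷ p) G = cong (proj₁ x * G (proj₂ x) +_) (pair≡∑ p G)

∑-ext : {X : Set} (xs : List X) {f g : X → ℚ} → (∀ x → f x ≡ g x) → ∑ xs f ≡ ∑ xs g
∑-ext [] e = refl
∑-ext (x ∷ xs) e = cong₂ _+_ (e x) (∑-ext xs e)

∑-add : {X : Set} (xs : List X) (f g : X → ℚ) → ∑ xs (λ x → f x + g x) ≡ ∑ xs f + ∑ xs g
∑-add [] f g = refl
∑-add (x ∷ xs) f g rewrite ∑-add xs f g =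
  solve 4 (λ a b c d → (a :+ b) :+ (c :+ d) := (a :+ c) :+ (b :+ d)) refl (f x) (g x) (∑ xs f) (∑ xs g)

∑-scal : {X : Set} (xs : List X) (k : ℚ) (f : X → ℚ) → ∑ xs (λ x → k * f x) ≡ k * ∑ xs f
∑-scal [] k f = sym (*-zeroʳ k)
∑-scal (x ∷ xs) k f rewrite ∑-scal xs k f =
  solve 3 (λ k a b → k :* a :+ k :* b := k :* (a :+ b)) refl k (f x) (∑ xs f)

∑-zero : {X : Set} (xs : List X) → ∑ xs (λ _ → 0ℚ) ≡ 0ℚ
∑-zero [] = refl
∑-zero (x ∷ xs) rewrite ∑-zero xs = refl

∑-neg : {X : Set} (xs : List X) (f : X → ℚ) → ∑ xs (λ x → - f x) ≡ - ∑ xs f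
∑-neg [] f = refl
∑-neg (x ∷ xs) f rewrite ∑-neg xs f = solve 2 (λ a b → :- a :+ :- b := :- (a :+ b)) refl (f x) (∑ xs f)

∑-++ : {X : Set} (xs ys : List X) (f : X → ℚ) → ∑ (xs ++ ys) f ≡ ∑ xs f + ∑ ys f
∑-++ [] ys f = sym (+-identityˡ _)
∑-++ (x ∷ xs) ys f rewrite ∑-++ xs ys f = sym (+-assoc (f x) (∑ xs f) (∑ ys f))

∑-map : {X Y : Set} (h : X → Y) (xs : List X) (f : Y → ℚ) → ∑ (map h xs) f ≡ ∑ xs (λ x → f (h x))
∑-map h [] f = refl
∑-map h (x ∷ xs) f = cong (f (h x) +_) (∑-map h xs f)

∑-concatMap : {X Y : Set} (h : X → List Y) (xs : List X) (f : Y → ℚ) → ∑ (concatMap h xs) f ≡ ∑ xs (λ x → ∑ (h x) f)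
∑-concatMap h [] f = refl
∑-concatMap h (x ∷ xs) f = trans (∑-++ (h x) (concatMap h xs) f) (cong (∑ (h x) f +_) (∑-concatMap h xs f))

∑-swap : {X Y : Set} (xs : List X) (ys : List Y) (F : X → Y → ℚ) →
  ∑ xs (λ x → ∑ ys (λ y → F x y)) ≡ ∑ ys (λ y → ∑ xs (λ x → F x y))
∑-swap [] ys F = sym (∑-zero ys)
∑-swap (x ∷ xs) ys F = trans (cong (∑ ys (F x) +_) (∑-swap xs ys F)) (sym (∑-add ys (F x) (λ y → ∑ xs (λ x → F x y))))

pair-∑ : {X : Set} (p : List (ℚ × I)) (xs : List X) (F : I → X → ℚ) →
  pair p (λ a → ∑ xs (λ x → F a x)) ≡ ∑ xs (λ x → pair p (λ a → F a x))
pair-∑ [] xs F = sym (∑-zero xs)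
pair-∑ ((c , a) ∷ p) xs F = begin
    c * ∑ xs (F a) + pair p (λ a → ∑ xs (λ x → F a x))
  ≡⟨ cong₂ _+_ (sym (∑-scal xs c (F a))) (pair-∑ p xs F) ⟩
    ∑ xs (λ x → c * F a x) + ∑ xs (λ x → pair p (λ a → F a x))
  ≡⟨ sym (∑-add xs (λ x → c * F a x) (λ x → pair p (λ a → F a x))) ⟩
    ∑ xs (λ x → c * F a x + pair p (λ a → F a x)) ∎
  where open ≡-Reasoning

pair-scaleP : ∀ a (p : Poly) G → pair (scaleP a p) G ≡ a * pair p G
pair-scaleP a [] G = sym (*-zeroʳ a)
pair-scaleP a ((c , w) ∷ p) G rewrite pair-scaleP a p G =
  solve 4 (λ a c g x → a :* c :* g :+ a :* x := a :* (c :* g :+ x)) refl a c (G w) (pair p G)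

pair-scaleL : ∀ a (p : LieC) G → pair (scaleL a p) G ≡ a * pair p G
pair-scaleL a [] G = sym (*-zeroʳ a)
pair-scaleL a ((c , w) ∷ p) G rewrite pair-scaleL a p G =
  solve 4 (λ a c g x → a :* c :* g :+ a :* x := a :* (c :* g :+ x)) refl a c (G w) (pair p G)

pair-*ₚ : ∀ (p q : Poly) G → pair (p *ₚ q) G ≡ pair p (λ u → pair q (λ v → G (u ++ v)))
pair-*ₚ p q G = trans (pair-concatMap _ p G) (trans (∑-ext p (λ { (c , u) →
   trans (pair-map _ q G) (trans (∑-ext q (λ { (e , w) → *-assoc c e (G (u ++ w)) }))
     (trans (∑-scal q c _) (cong (c *_) (sym (pair≡∑ q _)))) ) })) (sym (pair≡∑ p _)))

pair-wordP : ∀ w (G : Word → ℚ) → pair (wordP w) G ≡ G w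
pair-wordP w G = solve 1 (λ g → con 1ℚ :* g :+ con 0ℚ := g) refl (G w)

pair-letterP : ∀ k (G : Word → ℚ) → pair (letterP k) G ≡ G (k ∷ [])
pair-letterP k = pair-wordP (k ∷ [])

pair-lieP : ∀ (x : LieC) G → pair (lieP x) G ≡ pair x (λ t → pair (treeP t) G)
pair-lieP [] G = refl
pair-lieP ((c , t) ∷ x) G =
  trans (pair-++ (scaleP c (treeP t)) _ G) (cong₂ _+_ (pair-scaleP c (treeP t) G) (pair-lieP x G))

pair-▷L : ∀ (x y : LieC) F → pair (x ▷L y) F ≡ pair x (λ t → pair y (λ u → pair (t ▷t u) F))
pair-▷L x y F = trans (pair-concatMap _ x F) (trans (∑-ext x (λ { (c , t) →
   trans (pair-concatMap _ y F) (trans (∑-ext y (λ { (e , u) → trans (pair-scaleL (c * e) (t ▷t u) F) (*-assoc c e _) }))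
     (trans (∑-scal y c _) (cong (c *_) (sym (pair≡∑ y _)))) ) })) (sym (pair≡∑ x _)))

bracket : Poly → Poly → Poly
bracket P Q = (P *ₚ Q) +ₚ scaleP (- 1ℚ) (Q *ₚ P)

pair-bracket : ∀ P Q G → pair (bracket P Q) G ≡
  pair P (λ u → pair Q (λ v → G (u ++ v))) + - pair Q (λ v → pair P (λ u → G (v ++ u)))
pair-bracket P Q G =
  trans (pair-++ (P *ₚ Q) _ G)
   (cong₂ _+_ (pair-*ₚ P Q G)
     (trans (pair-scaleP (- 1ℚ) (Q *ₚ P) G)
       (trans (cong (- 1ℚ *_) (pair-*ₚ Q P G)) (solve 1 (λ x → con (- 1ℚ) :* x := :- x) refl _))))

pair-antipode : ∀ (p : Poly) G → pair (antipode p) G ≡ pair p (λ w → sgn (length w) * G (reverse w))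
pair-antipode [] G = refl
pair-antipode ((c , w) ∷ p) G rewrite pair-antipode p G =
  cong (_+ pair p (λ w → sgn (length w) * G (reverse w)))
    (solve 3 (λ s c g → s :* c :* g := c :* (s :* g)) refl (sgn (length w)) c (G (reverse w)))

δ : Word → Word → ℚ
δ w u with ≡-dec ℕ._≟_ u w
... | yes _ = 1ℚ
... | no  _ = 0ℚ

coeff-pair : ∀ (p : Poly) w → coeff p w ≡ pair p (δ w)
coeff-pair [] w = refl
coeff-pair ((c , u) ∷ p) w with ≡-dec ℕ._≟_ u w
... | yes _ = trans (cong (c +_) (coeff-pair p w)) (cong (_+ pair p (δ w)) (sym (*-identityʳ c)))
... | no  _ = trans (coeff-pair p w) (solve 2 (λ c x → x := c :* con 0ℚ :+ x) refl c (pair p (δ w)))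

∼⇒≈ : ∀ {p q : Poly} → p ∼ q → p ≈ₚ q
∼⇒≈ {p} {q} e w = trans (coeff-pair p w) (trans (e (δ w)) (sym (coeff-pair q w)))

-- Ari multiplicities

ℕtoℚ-+-homo : ∀ m n → ℕtoℚ (m ℕ.+ n) ≡ ℕtoℚ m + ℕtoℚ n
ℕtoℚ-+-homo m n = toℚᵘ-injective (UP.≃-trans (toℚᵘ-fromℚᵘ (U.mkℚᵘ (ℤ.+ (m ℕ.+ n)) 0))
   (UP.≃-trans eq (UP.≃-sym (UP.≃-trans (toℚᵘ-homo-+ (ℕtoℚ m) (ℕtoℚ n))
      (UP.+-cong (toℚᵘ-fromℚᵘ (U.mkℚᵘ (ℤ.+ m) 0)) (toℚᵘ-fromℚᵘ (U.mkℚᵘ (ℤ.+ n) 0)))))))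
  where
  eq : U.mkℚᵘ (ℤ.+ (m ℕ.+ n)) 0 U.≃ (U.mkℚᵘ (ℤ.+ m) 0 U.+ U.mkℚᵘ (ℤ.+ n) 0)
  eq = U.*≡* (begin
      ℤ.+ (m ℕ.+ n) ℤ.* ℤ.+ 1 ≡⟨ ZP.*-identityʳ _ ⟩
      ℤ.+ (m ℕ.+ n) ≡⟨ ZP.pos-+ m n ⟩
      ℤ.+ m ℤ.+ ℤ.+ n ≡⟨ sym (cong₂ ℤ._+_ (ZP.*-identityʳ (ℤ.+ m)) (ZP.*-identityʳ (ℤ.+ n))) ⟩
      ℤ.+ m ℤ.* ℤ.+ 1 ℤ.+ ℤ.+ n ℤ.* ℤ.+ 1 ≡⟨ sym (ZP.*-identityʳ _) ⟩
      (ℤ.+ m ℤ.* ℤ.+ 1 ℤ.+ ℤ.+ n ℤ.* ℤ.+ 1) ℤ.* ℤ.+ 1 ∎)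
    where open ≡-Reasoning

sgn-+ : ∀ m n → sgn (m ℕ.+ n) ≡ sgn m * sgn n
sgn-+ zero n = sym (*-identityˡ (sgn n))
sgn-+ (suc m) n = trans (cong -_ (sgn-+ m n)) (neg-distribˡ-* (sgn m) (sgn n))

m₁ : ℕ → ℕ → ℚ
m₁ c l = sgn (c ℕ.+ l) * binom₋₁ c l

mult-∷ : ∀ c k l0 l → mult (c ∷ k) (l0 ∷ l) ≡ m₁ c l0 * mult k l
mult-∷ c k l0 l = begin
    sgn ((c ℕ.+ sum k) ℕ.+ (l0 ℕ.+ sum l)) * (binom₋₁ c l0 * prodBinom k l)
  ≡⟨ cong (λ z → sgn z * (binom₋₁ c l0 * prodBinom k l)) (ℕ-interchange c (sum k) l0 (sum l)) ⟩
    sgn ((c ℕ.+ l0) ℕ.+ (sum k ℕ.+ sum l)) * (binom₋₁ c l0 * prodBinom k l)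
  ≡⟨ cong (_* (binom₋₁ c l0 * prodBinom k l)) (sgn-+ (c ℕ.+ l0) (sum k ℕ.+ sum l)) ⟩
    sgn (c ℕ.+ l0) * sgn (sum k ℕ.+ sum l) * (binom₋₁ c l0 * prodBinom k l)
  ≡⟨ solve 4 (λ a b x y → a :* b :* (x :* y) := a :* x :* (b :* y)) refl (sgn (c ℕ.+ l0)) (sgn (sum k ℕ.+ sum l)) (binom₋₁ c l0) (prodBinom k l) ⟩
    m₁ c l0 * mult k l ∎
  where
  open ≡-Reasoning

m₁-suc-zero : ∀ c → m₁ (suc c) 0 ≡ 0ℚ
m₁-suc-zero c = *-zeroʳ (sgn (suc c ℕ.+ 0))

m₁-vanish : ∀ {c q} → c < q → m₁ c q ≡ 0ℚ
m₁-vanish {zero} {suc q} _ = *-zeroʳ (sgn (suc q))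
m₁-vanish {suc c} {suc q} (s≤s c<q) = trans (cong (λ z → sgn (suc c ℕ.+ suc q) * ℕtoℚ z) (k>n⇒nCk≡0 c<q)) (*-zeroʳ (sgn (suc c ℕ.+ suc q)))

nC0≡1 : ∀ n → n C 0 ≡ 1
nC0≡1 n = trans (nCk≡nC[n∸k] {0} {n} z≤n) (nCn≡1 n)

sgn-suc-suc : ∀ n → sgn (suc (suc n)) ≡ sgn n
sgn-suc-suc n = solve 1 (λ x → :- (:- x) := x) refl (sgn n)

m₁-suc-suc : ∀ c L → m₁ (suc c) (suc L) ≡ sgn (c ℕ.+ L) * ℕtoℚ (c C L)
m₁-suc-suc c L = cong (_* ℕtoℚ (c C L)) (trans (cong (λ z → sgn (suc z)) (NP.+-suc c L)) (sgn-suc-suc (c ℕ.+ L)))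

m₁-pascal : ∀ c L → m₁ (suc c) (suc L) ≡ m₁ c L + - m₁ c (suc L)
m₁-pascal zero zero = refl
m₁-pascal zero (suc L) = trans (m₁-suc-suc 0 (suc L)) (trans (cong (λ z → sgn (suc L) * ℕtoℚ z) (k>n⇒nCk≡0 {0} {suc L} (s≤s z≤n)))
  (solve 3 (λ a b x → a :* con 0ℚ := b :* con 0ℚ :+ :- (x :* con 0ℚ)) refl (sgn (suc L)) (sgn (0 ℕ.+ suc L)) (sgn (0 ℕ.+ suc (suc L)))))
m₁-pascal (suc c) zero = begin
    m₁ (suc (suc c)) 1
  ≡⟨ m₁-suc-suc (suc c) 0 ⟩
    sgn (suc c ℕ.+ 0) * ℕtoℚ (suc c C 0)
  ≡⟨ cong₂ (λ a b → sgn a * ℕtoℚ b) (NP.+-identityʳ (suc c)) (nC0≡1 (suc c)) ⟩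
    sgn (suc c) * 1ℚ
  ≡⟨ solve 2 (λ x y → :- x :* con 1ℚ := y :* con 0ℚ :+ :- (x :* con 1ℚ)) refl (sgn c) (sgn (suc c ℕ.+ 0)) ⟩
    m₁ (suc c) 0 + - (sgn c * ℕtoℚ 1)
  ≡⟨ cong (λ z → m₁ (suc c) 0 + - (sgn c * ℕtoℚ z)) (sym (nC0≡1 c)) ⟩
    m₁ (suc c) 0 + - (sgn c * ℕtoℚ (c C 0))
  ≡⟨ cong (λ z → m₁ (suc c) 0 + - z) (sym (trans (m₁-suc-suc c 0) (cong (λ a → sgn a * ℕtoℚ (c C 0)) (NP.+-identityʳ c)))) ⟩
    m₁ (suc c) 0 + - m₁ (suc c) 1 ∎
  where open ≡-Reasoning
m₁-pascal (suc c) (suc L) = begin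
    m₁ (suc (suc c)) (suc (suc L))
  ≡⟨ m₁-suc-suc (suc c) (suc L) ⟩
    sgn (suc c ℕ.+ suc L) * ℕtoℚ (suc c C suc L)
  ≡⟨ cong (λ z → sgn (suc c ℕ.+ suc L) * ℕtoℚ z) (sym (nCk+nC[k+1]≡[n+1]C[k+1] c L)) ⟩
    sgn (suc c ℕ.+ suc L) * ℕtoℚ (c C L ℕ.+ c C suc L)
  ≡⟨ cong (sgn (suc c ℕ.+ suc L) *_) (ℕtoℚ-+-homo (c C L) (c C suc L)) ⟩
    sgn (suc c ℕ.+ suc L) * (ℕtoℚ (c C L) + ℕtoℚ (c C suc L))
  ≡⟨ cong (λ z → z * (ℕtoℚ (c C L) + ℕtoℚ (c C suc L))) sgn[2+c+L] ⟩
    sgn (c ℕ.+ L) * (ℕtoℚ (c C L) + ℕtoℚ (c C suc L))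
  ≡⟨ solve 3 (λ s x y → s :* (x :+ y) := s :* x :+ :- ((:- s) :* y)) refl (sgn (c ℕ.+ L)) (ℕtoℚ (c C L)) (ℕtoℚ (c C suc L)) ⟩
    sgn (c ℕ.+ L) * ℕtoℚ (c C L) + - (- sgn (c ℕ.+ L) * ℕtoℚ (c C suc L))
  ≡⟨ cong₂ (λ a b → a + - b) (sym (m₁-suc-suc c L)) (cong (_* ℕtoℚ (c C suc L)) sgn[3+c+L]) ⟩
    m₁ (suc c) (suc L) + - m₁ (suc c) (suc (suc L)) ∎
  where
  open ≡-Reasoning
  sgn[2+c+L] : sgn (suc c ℕ.+ suc L) ≡ sgn (c ℕ.+ L)
  sgn[2+c+L] = trans (cong (λ z → sgn (suc z)) (NP.+-suc c L)) (sgn-suc-suc (c ℕ.+ L))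
  sgn[3+c+L] : - sgn (c ℕ.+ L) ≡ sgn (suc c ℕ.+ suc (suc L))
  sgn[3+c+L] = sym (trans (cong (λ z → sgn (suc z)) (NP.+-suc c (suc L))) (cong -_ (trans (cong (λ z → sgn (suc z)) (NP.+-suc c L)) (sgn-suc-suc (c ℕ.+ L)))))

∑< : ℕ → (ℕ → ℚ) → ℚ
∑< zero F = 0ℚ
∑< (suc n) F = F 0 + ∑< n (λ i → F (suc i))

∑-applyUpTo : ∀ (f : ℕ → ℕ) n (F : ℕ → ℚ) → ∑ (applyUpTo f n) F ≡ ∑< n (λ i → F (f i))
∑-applyUpTo f zero F = refl
∑-applyUpTo f (suc n) F = cong (F (f 0) +_) (∑-applyUpTo (λ i → f (suc i)) n F)

∑-upTo : ∀ n (F : ℕ → ℚ) → ∑ (upTo n) F ≡ ∑< n F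
∑-upTo = ∑-applyUpTo (λ i → i)

∑<-ext : ∀ n {F G : ℕ → ℚ} → (∀ i → F i ≡ G i) → ∑< n F ≡ ∑< n G
∑<-ext zero e = refl
∑<-ext (suc n) e = cong₂ _+_ (e 0) (∑<-ext n (λ i → e (suc i)))

∑<-ext< : ∀ n {F G : ℕ → ℚ} → (∀ i → i < n → F i ≡ G i) → ∑< n F ≡ ∑< n G
∑<-ext< zero e = refl
∑<-ext< (suc n) e = cong₂ _+_ (e 0 (s≤s z≤n)) (∑<-ext< n (λ i i<n → e (suc i) (s≤s i<n)))

∑<-add : ∀ n (F G : ℕ → ℚ) → ∑< n (λ i → F i + G i) ≡ ∑< n F + ∑< n G
∑<-add zero F G = refl
∑<-add (suc n) F G rewrite ∑<-add n (λ i → F (suc i)) (λ i → G (suc i)) =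
  solve 4 (λ a b c d → (a :+ b) :+ (c :+ d) := (a :+ c) :+ (b :+ d)) refl (F 0) (G 0) (∑< n (λ i → F (suc i))) (∑< n (λ i → G (suc i)))

∑<-scal : ∀ n (k : ℚ) (F : ℕ → ℚ) → ∑< n (λ i → k * F i) ≡ k * ∑< n F
∑<-scal zero k F = sym (*-zeroʳ k)
∑<-scal (suc n) k F rewrite ∑<-scal n k (λ i → F (suc i)) =
  solve 3 (λ k a b → k :* a :+ k :* b := k :* (a :+ b)) refl k (F 0) (∑< n (λ i → F (suc i)))

∑<-neg : ∀ n (F : ℕ → ℚ) → ∑< n (λ i → - F i) ≡ - ∑< n F
∑<-neg zero F = refl
∑<-neg (suc n) F rewrite ∑<-neg n (λ i → F (suc i)) =
  solve 2 (λ a b → :- a :+ :- b := :- (a :+ b)) refl (F 0) (∑< n (λ i → F (suc i)))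

∑<-zero : ∀ n → ∑< n (λ _ → 0ℚ) ≡ 0ℚ
∑<-zero zero = refl
∑<-zero (suc n) rewrite ∑<-zero n = refl

∑<-vanish : ∀ n (F : ℕ → ℚ) → (∀ i → F i ≡ 0ℚ) → ∑< n F ≡ 0ℚ
∑<-vanish n F e = trans (∑<-ext n e) (∑<-zero n)

∑<-last : ∀ n (F : ℕ → ℚ) → ∑< (suc n) F ≡ ∑< n F + F n
∑<-last zero F = +-comm (F 0) 0ℚ
∑<-last (suc n) F rewrite ∑<-last n (λ i → F (suc i)) = sym (+-assoc (F 0) _ (F (suc n)))

∑<-swap : ∀ n m (F : ℕ → ℕ → ℚ) → ∑< n (λ i → ∑< m (λ j → F i j)) ≡ ∑< m (λ j → ∑< n (λ i → F i j))
∑<-swap zero m F = sym (∑<-zero m)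
∑<-swap (suc n) m F = trans (cong (∑< m (F 0) +_) (∑<-swap n m (λ i → F (suc i))))
   (sym (∑<-add m (F 0) (λ j → ∑< n (λ i → F (suc i) j))))

∑<-∑-swap : ∀ {X : Set} n (xs : List X) (F : ℕ → X → ℚ) → ∑< n (λ i → ∑ xs (λ x → F i x)) ≡ ∑ xs (λ x → ∑< n (λ i → F i x))
∑<-∑-swap zero xs F = sym (∑-zero xs)
∑<-∑-swap (suc n) xs F = trans (cong (∑ xs (F 0) +_) (∑<-∑-swap n xs (λ i → F (suc i))))
   (sym (∑-add xs (F 0) (λ x → ∑< n (λ i → F (suc i) x))))

∑<-sub : ∀ n (F G : ℕ → ℚ) → ∑< n (λ i → F i + - G i) ≡ ∑< n F + - ∑< n G
∑<-sub n F G = trans (∑<-add n F (λ i → - G i)) (cong (∑< n F +_) (∑<-neg n G))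

∑<-head-vanish : ∀ n (F : ℕ → ℚ) → F 0 ≡ 0ℚ → ∑< (suc n) F ≡ ∑< n (λ i → F (suc i))
∑<-head-vanish n F F0≡0 = trans (cong (_+ ∑< n (λ i → F (suc i))) F0≡0) (+-identityˡ _)

∑<-last-vanish : ∀ n (F : ℕ → ℚ) → F n ≡ 0ℚ → ∑< (suc n) F ≡ ∑< n F
∑<-last-vanish n F Fn≡0 = trans (∑<-last n F) (trans (cong (∑< n F +_) Fn≡0) (+-identityʳ _))

∑<-+ : ∀ n d (F : ℕ → ℚ) → ∑< (n ℕ.+ d) F ≡ ∑< n F + ∑< d (λ i → F (n ℕ.+ i))
∑<-+ zero d F = sym (+-identityˡ (∑< d F))
∑<-+ (suc n) d F = trans (cong (F 0 +_) (∑<-+ n d (λ i → F (suc i))))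
  (sym (+-assoc (F 0) (∑< n (λ i → F (suc i))) (∑< d (λ i → F (suc (n ℕ.+ i))))))

∑<-extend : ∀ {m n} (F : ℕ → ℚ) → m ≤ n → (∀ i → m < i → F i ≡ 0ℚ) → ∑< (suc m) F ≡ ∑< (suc n) F
∑<-extend {m} {n} F m≤n F>m≡0 = sym (begin
    ∑< (suc n) F                                          ≡⟨ cong (λ d → ∑< d F) (NP.m+[n∸m]≡n (s≤s m≤n)) ⟨
    ∑< (suc m ℕ.+ (n ∸ m)) F                              ≡⟨ ∑<-+ (suc m) (n ∸ m) F ⟩
    ∑< (suc m) F + ∑< (n ∸ m) (λ i → F (suc m ℕ.+ i))     ≡⟨ cong (∑< (suc m) F +_) tail≡0 ⟩
    ∑< (suc m) F + 0ℚ                                     ≡⟨ +-identityʳ (∑< (suc m) F) ⟩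
    ∑< (suc m) F                                          ∎)
  where
  open ≡-Reasoning
  tail≡0 : ∑< (n ∸ m) (λ i → F (suc m ℕ.+ i)) ≡ 0ℚ
  tail≡0 = ∑<-vanish (n ∸ m) (λ i → F (suc m ℕ.+ i)) (λ i → F>m≡0 (suc m ℕ.+ i) (s≤s (NP.m≤m+n m i)))

m₁-vanish-* : ∀ {c q} → c < q → ∀ x → m₁ c q * x ≡ 0ℚ
m₁-vanish-* c<q x = trans (cong (_* x) (m₁-vanish c<q)) (*-zeroˡ x)

m₁-suc-zero-* : ∀ c x → m₁ (suc c) 0 * x ≡ 0ℚ
m₁-suc-zero-* c x = trans (cong (_* x) (m₁-suc-zero c)) (*-zeroˡ x)

-- 𝕄 b applies the coefficients of the polynomial Σ_p m₁ b p xᵖ, which is x(x-1)^(b-1) for b ≥ 1.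
𝕄 : ℕ → (ℕ → ℚ) → ℚ
𝕄 b f = ∑< (suc b) (λ p → m₁ b p * f p)

𝕄-ext : ∀ b {f g : ℕ → ℚ} → (∀ p → f p ≡ g p) → 𝕄 b f ≡ 𝕄 b g
𝕄-ext b e = ∑<-ext (suc b) (λ p → cong (m₁ b p *_) (e p))

𝕄-ext< : ∀ b {f g : ℕ → ℚ} → (∀ p → p < suc b → f p ≡ g p) → 𝕄 b f ≡ 𝕄 b g
𝕄-ext< b e = ∑<-ext< (suc b) (λ p lt → cong (m₁ b p *_) (e p lt))

𝕄-∑< : ∀ b n (w : ℕ → ℚ) (F : ℕ → ℕ → ℚ) →
  𝕄 b (λ j → ∑< n (λ i → w i * F i j)) ≡ ∑< n (λ i → w i * 𝕄 b (F i))
𝕄-∑< b n w F = begin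
    ∑< (suc b) (λ p → m₁ b p * ∑< n (λ i → w i * F i p))
  ≡⟨ ∑<-ext (suc b) (λ p → sym (∑<-scal n (m₁ b p) (λ i → w i * F i p))) ⟩
    ∑< (suc b) (λ p → ∑< n (λ i → m₁ b p * (w i * F i p)))
  ≡⟨ ∑<-swap (suc b) n (λ p i → m₁ b p * (w i * F i p)) ⟩
    ∑< n (λ i → ∑< (suc b) (λ p → m₁ b p * (w i * F i p)))
  ≡⟨ ∑<-ext n (λ i → trans (∑<-ext (suc b) (λ p → m*[w*x]≡w*[m*x] (m₁ b p) (w i) (F i p)))
                            (∑<-scal (suc b) (w i) (λ p → m₁ b p * F i p))) ⟩
    ∑< n (λ i → w i * 𝕄 b (F i)) ∎
  where
  open ≡-Reasoning
  m*[w*x]≡w*[m*x] : ∀ m w x → m * (w * x) ≡ w * (m * x)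
  m*[w*x]≡w*[m*x] = solve 3 (λ m w x → m :* (w :* x) := w :* (m :* x)) refl

𝕄-suc : ∀ a (f : ℕ → ℚ) → 𝕄 (suc a) f ≡ ∑< (suc (suc a)) (λ p → m₁ (suc a) (suc p) * f (suc p))
𝕄-suc a f = begin
    𝕄 (suc a) f           ≡⟨ ∑<-head-vanish (suc a) (λ p → m₁ (suc a) p * f p) (m₁-suc-zero-* a (f 0)) ⟩
    ∑< (suc a) G          ≡⟨ ∑<-last-vanish (suc a) G (m₁-vanish-* (NP.n<1+n (suc a)) (f (suc (suc a)))) ⟨
    ∑< (suc (suc a)) G    ∎
  where
  open ≡-Reasoning
  G : ℕ → ℚ
  G p = m₁ (suc a) (suc p) * f (suc p)

𝕄-suc-suc : ∀ a (f : ℕ → ℚ) →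
  𝕄 (suc (suc a)) f ≡ 𝕄 (suc a) (λ p → f (suc p)) + - ∑< (suc (suc a)) (λ p → m₁ (suc a) (suc p) * f (suc p))
𝕄-suc-suc a f = begin
    𝕄 (suc (suc a)) f
  ≡⟨ ∑<-head-vanish (suc (suc a)) (λ p → m₁ (suc (suc a)) p * f p) (m₁-suc-zero-* (suc a) (f 0)) ⟩
    ∑< (suc (suc a)) (λ p → m₁ (suc (suc a)) (suc p) * f (suc p))
  ≡⟨ ∑<-ext (suc (suc a)) (λ p → trans (cong (_* f (suc p)) (m₁-pascal (suc a) p))
       (solve 3 (λ x y z → (x :+ :- y) :* z := x :* z :+ :- (y :* z)) refl (m₁ (suc a) p) (m₁ (suc a) (suc p)) (f (suc p)))) ⟩
    ∑< (suc (suc a)) (λ p → m₁ (suc a) p * f (suc p) + - (m₁ (suc a) (suc p) * f (suc p)))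
  ≡⟨ ∑<-sub (suc (suc a)) (λ p → m₁ (suc a) p * f (suc p)) (λ p → m₁ (suc a) (suc p) * f (suc p)) ⟩
    𝕄 (suc a) (λ p → f (suc p)) + - ∑< (suc (suc a)) (λ p → m₁ (suc a) (suc p) * f (suc p)) ∎
  where open ≡-Reasoning

-- x(x-1)^a + x(x-1)^(a+1) = x(x-1)^a · x
𝕄-pascal : ∀ a (f : ℕ → ℚ) → 𝕄 (suc a) f + 𝕄 (suc (suc a)) f ≡ 𝕄 (suc a) (λ p → f (suc p))
𝕄-pascal a f = begin
    𝕄 (suc a) f + 𝕄 (suc (suc a)) f    ≡⟨ cong₂ _+_ (𝕄-suc a f) (𝕄-suc-suc a f) ⟩
    X + (𝕄 (suc a) (f ∘ suc) + - X)    ≡⟨ solve 2 (λ x y → x :+ (y :+ :- x) := y) refl X (𝕄 (suc a) (f ∘ suc)) ⟩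
    𝕄 (suc a) (f ∘ suc)                ∎
  where
  open ≡-Reasoning
  X = ∑< (suc (suc a)) (λ p → m₁ (suc a) (suc p) * f (suc p))

m₁-chain : ℕ → ℕ → ℕ → (ℕ → ℚ) → ℚ
m₁-chain c q a f = ∑< (suc c) (λ l → m₁ c l * (m₁ l q * 𝕄 (suc a ℕ.+ (c ∸ l)) f))

∸-suc< : ∀ {l c} → l < c → c ∸ l ≡ suc (c ∸ suc l)
∸-suc< {l} {c} l<c = NP.+-∸-assoc 1 {c} {suc l} l<c

m₁-chain-suc-suc : ∀ c q a (f : ℕ → ℚ) →
  m₁-chain (suc c) (suc q) a f ≡ (m₁-chain c q a f + - m₁-chain c (suc q) a f) + - m₁-chain c (suc q) (suc a) f
m₁-chain-suc-suc c q a f = begin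
    m₁-chain (suc c) (suc q) a f
  ≡⟨ ∑<-head-vanish (suc c) (λ l → m₁ (suc c) l * (m₁ l (suc q) * 𝕄 (suc a ℕ.+ (suc c ∸ l)) f)) (m₁-suc-zero-* c (m₁ 0 (suc q) * 𝕄 (suc a ℕ.+ suc c) f)) ⟩
    ∑< (suc c) (λ l → m₁ (suc c) (suc l) * (m₁ (suc l) (suc q) * M l))
  ≡⟨ ∑<-ext (suc c) expand ⟩
    ∑< (suc c) (λ l → (P l + - Q l) + - R l)
  ≡⟨ ∑<-sub (suc c) (λ l → P l + - Q l) R ⟩
    ∑< (suc c) (λ l → P l + - Q l) + - ∑< (suc c) R
  ≡⟨ cong₂ (λ x y → x + - y) (∑<-sub (suc c) P Q) shift ⟩
    (m₁-chain c q a f + - m₁-chain c (suc q) a f) + - m₁-chain c (suc q) (suc a) f ∎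
  where
  open ≡-Reasoning
  M P Q R : ℕ → ℚ
  M l = 𝕄 (suc a ℕ.+ (c ∸ l)) f
  P l = m₁ c l * (m₁ l q * M l)
  Q l = m₁ c l * (m₁ l (suc q) * M l)
  R l = m₁ c (suc l) * (m₁ (suc l) (suc q) * M l)
  expand : ∀ l → m₁ (suc c) (suc l) * (m₁ (suc l) (suc q) * M l) ≡ (P l + - Q l) + - R l
  expand l = trans (cong₂ (λ x u → x * (u * M l)) (m₁-pascal c l) (m₁-pascal l q))
    (trans (solve 5 (λ x y u v t → (x :+ :- y) :* ((u :+ :- v) :* t) := (x :* (u :* t) :+ :- (x :* (v :* t))) :+ :- (y :* ((u :+ :- v) :* t))) refl
             (m₁ c l) (m₁ c (suc l)) (m₁ l q) (m₁ l (suc q)) (M l))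
      (cong (λ w → (P l + - Q l) + - (m₁ c (suc l) * (w * M l))) (sym (m₁-pascal l q))))
  shift : ∑< (suc c) R ≡ m₁-chain c (suc q) (suc a) f
  shift = begin
      ∑< (suc c) R
    ≡⟨ ∑<-last-vanish c R (m₁-vanish-* (NP.n<1+n c) (m₁ (suc c) (suc q) * M c)) ⟩
      ∑< c R
    ≡⟨ ∑<-ext< c (λ l l<c → cong (λ n → m₁ c (suc l) * (m₁ (suc l) (suc q) * 𝕄 n f))
                  (trans (cong (suc a ℕ.+_) (∸-suc< l<c)) (NP.+-suc (suc a) (c ∸ suc l)))) ⟩
      ∑< c (λ l → m₁ c (suc l) * (m₁ (suc l) (suc q) * 𝕄 (suc (suc a) ℕ.+ (c ∸ suc l)) f))
    ≡⟨ ∑<-head-vanish c (λ l → m₁ c l * (m₁ l (suc q) * 𝕄 (suc (suc a) ℕ.+ (c ∸ l)) f))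
         (trans (cong (m₁ c 0 *_) (m₁-vanish-* {0} {suc q} (s≤s z≤n) (𝕄 (suc (suc a) ℕ.+ c) f))) (*-zeroʳ (m₁ c 0))) ⟨
      m₁-chain c (suc q) (suc a) f ∎

m₁-*-𝕄-pascal : ∀ c q a (f : ℕ → ℚ) →
  m₁ c (suc q) * (𝕄 (suc a) (λ p → f (p ℕ.+ (c ∸ suc q))) + 𝕄 (suc (suc a)) (λ p → f (p ℕ.+ (c ∸ suc q))))
  ≡ m₁ c (suc q) * 𝕄 (suc a) (λ p → f (p ℕ.+ (c ∸ q)))
m₁-*-𝕄-pascal c q a f with suc q ℕ.≤? c
... | yes q<c = cong (m₁ c (suc q) *_) (trans (𝕄-pascal a (λ p → f (p ℕ.+ (c ∸ suc q)))) (𝕄-ext (suc a) (λ p →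
      cong f (trans (sym (NP.+-suc p (c ∸ suc q))) (cong (p ℕ.+_) (sym (∸-suc< q<c)))))))
... | no q≮c = trans (m₁-vanish-* c<1+q _) (sym (m₁-vanish-* c<1+q _))
  where c<1+q = NP.≰⇒> q≮c

m₁-chain-collapse : ∀ c q a (f : ℕ → ℚ) → m₁-chain c q a f ≡ m₁ c q * 𝕄 (suc a) (λ p → f (p ℕ.+ (c ∸ q)))
m₁-chain-collapse zero zero a f = trans (solve 1 (λ t → con 1ℚ :* (con 1ℚ :* t) :+ con 0ℚ := con 1ℚ :* t) refl (𝕄 (suc a ℕ.+ 0) f))
  (cong (1ℚ *_) (trans (cong (λ b → 𝕄 b f) (NP.+-identityʳ (suc a))) (𝕄-ext (suc a) (λ p → cong f (sym (NP.+-identityʳ p))))))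
m₁-chain-collapse zero (suc q) a f =
  trans (cong (λ x → m₁ 0 0 * x + 0ℚ) (m₁-vanish-* {0} {suc q} (s≤s z≤n) (𝕄 (suc a ℕ.+ 0) f)))
        (trans (solve 1 (λ m → m :* con 0ℚ :+ con 0ℚ := con 0ℚ) refl (m₁ 0 0)) (sym (m₁-vanish-* {0} {suc q} (s≤s z≤n) (𝕄 (suc a) (λ p → f (p ℕ.+ 0))))))
m₁-chain-collapse (suc c) zero a f = trans (∑<-vanish (suc (suc c)) _ term≡0) (sym (m₁-suc-zero-* c (𝕄 (suc a) (λ p → f (p ℕ.+ suc c)))))
  where
  term≡0 : ∀ l → m₁ (suc c) l * (m₁ l 0 * 𝕄 (suc a ℕ.+ (suc c ∸ l)) f) ≡ 0ℚ
  term≡0 zero    = m₁-suc-zero-* c (m₁ 0 0 * 𝕄 (suc a ℕ.+ suc c) f)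
  term≡0 (suc l) = trans (cong (m₁ (suc c) (suc l) *_) (m₁-suc-zero-* l (𝕄 (suc a ℕ.+ (c ∸ l)) f))) (*-zeroʳ (m₁ (suc c) (suc l)))
m₁-chain-collapse (suc c) (suc q) a f = begin
    m₁-chain (suc c) (suc q) a f
  ≡⟨ m₁-chain-suc-suc c q a f ⟩
    (m₁-chain c q a f + - m₁-chain c (suc q) a f) + - m₁-chain c (suc q) (suc a) f
  ≡⟨ cong₂ (λ x y → x + - y) (cong₂ (λ x y → x + - y) (m₁-chain-collapse c q a f) (m₁-chain-collapse c (suc q) a f))
           (m₁-chain-collapse c (suc q) (suc a) f) ⟩
    (m₁ c q * T + - (m₁ c (suc q) * 𝕄 (suc a) g)) + - (m₁ c (suc q) * 𝕄 (suc (suc a)) g)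
  ≡⟨ solve 5 (λ x y t u v → (x :* t :+ :- (y :* u)) :+ :- (y :* v) := x :* t :+ :- (y :* (u :+ v))) refl
       (m₁ c q) (m₁ c (suc q)) T (𝕄 (suc a) g) (𝕄 (suc (suc a)) g) ⟩
    m₁ c q * T + - (m₁ c (suc q) * (𝕄 (suc a) g + 𝕄 (suc (suc a)) g))
  ≡⟨ cong (λ x → m₁ c q * T + - x) (m₁-*-𝕄-pascal c q a f) ⟩
    m₁ c q * T + - (m₁ c (suc q) * T)
  ≡⟨ solve 3 (λ x y t → x :* t :+ :- (y :* t) := (x :+ :- y) :* t) refl (m₁ c q) (m₁ c (suc q)) T ⟩
    (m₁ c q + - m₁ c (suc q)) * T
  ≡⟨ cong (_* T) (m₁-pascal c q) ⟨
    m₁ (suc c) (suc q) * T ∎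
  where
  open ≡-Reasoning
  T = 𝕄 (suc a) (λ p → f (p ℕ.+ (c ∸ q)))
  g : ℕ → ℚ
  g p = f (p ℕ.+ (c ∸ suc q))

data InBox : Word → Word → Set where
  ib[] : InBox [] []
  ib∷ : ∀ {c l0 k l} → l0 ≤ c → InBox k l → InBox (c ∷ k) (l0 ∷ l)

InBox-sum : ∀ {k l} → InBox k l → sum l ≤ sum k
InBox-sum ib[] = z≤n
InBox-sum (ib∷ a b) = NP.+-mono-≤ a (InBox-sum b)

∑-box-∷ : ∀ c k (F : Word → ℚ) → ∑ (box (c ∷ k)) F ≡ ∑< (suc c) (λ l0 → ∑ (box k) (λ l → F (l0 ∷ l)))
∑-box-∷ c k F = trans (∑-concatMap (λ l → map (l ∷_) (box k)) (upTo (suc c)) F)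
  (trans (∑-upTo (suc c) (λ l0 → ∑ (map (l0 ∷_) (box k)) F)) (∑<-ext (suc c) (λ l0 → ∑-map (l0 ∷_) (box k) F)))

∑-box-ext : ∀ k {F G : Word → ℚ} → (∀ l → InBox k l → F l ≡ G l) → ∑ (box k) F ≡ ∑ (box k) G
∑-box-ext [] e = cong (_+ 0ℚ) (e [] ib[])
∑-box-ext (c ∷ k) {F} {G} e = trans (∑-box-∷ c k F) (trans
  (∑<-ext< (suc c) (λ l0 l0<sc → ∑-box-ext k (λ l ib → e (l0 ∷ l) (ib∷ (NP.≤-pred l0<sc) ib))))
  (sym (∑-box-∷ c k G)))

∑-box-++ : ∀ u v (F : Word → ℚ) → ∑ (box (u ++ v)) F ≡ ∑ (box u) (λ l1 → ∑ (box v) (λ l2 → F (l1 ++ l2)))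
∑-box-++ [] v F = sym (+-identityʳ (∑ (box v) F))
∑-box-++ (c ∷ u) v F = trans (∑-box-∷ c (u ++ v) F) (trans
  (∑<-ext (suc c) (λ l0 → ∑-box-++ u v (λ l → F (l0 ∷ l))))
  (sym (∑-box-∷ c u (λ l1 → ∑ (box v) (λ l2 → F (l1 ++ l2))))))

mult-++ : ∀ {u l1} → InBox u l1 → ∀ v l2 → mult (u ++ v) (l1 ++ l2) ≡ mult u l1 * mult v l2
mult-++ ib[] v l2 = sym (*-identityˡ (mult v l2))
mult-++ (ib∷ {c} {l0} {u} {l1} _ ib) v l2 = trans (mult-∷ c (u ++ v) l0 (l1 ++ l2))
  (trans (cong (m₁ c l0 *_) (mult-++ ib v l2))
   (trans (sym (*-assoc (m₁ c l0) (mult u l1) (mult v l2))) (cong (_* mult v l2) (sym (mult-∷ c u l0 l1)))))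

∑ₘ : Word → (Word → ℚ) → ℚ
∑ₘ k F = ∑ (box k) (λ l → mult k l * F l)

∑ₘ-ext : ∀ k {F G : Word → ℚ} → (∀ l → InBox k l → F l ≡ G l) → ∑ₘ k F ≡ ∑ₘ k G
∑ₘ-ext k e = ∑-box-ext k (λ l ib → cong (mult k l *_) (e l ib))

∑ₘ-∷ : ∀ c k (F : Word → ℚ) → ∑ₘ (c ∷ k) F ≡ ∑< (suc c) (λ q₀ → m₁ c q₀ * ∑ₘ k (λ q → F (q₀ ∷ q)))
∑ₘ-∷ c k F = trans (∑-box-∷ c k (λ q → mult (c ∷ k) q * F q)) (∑<-ext (suc c) (λ q₀ →
  trans (∑-ext (box k) (λ q → trans (cong (_* F (q₀ ∷ q)) (mult-∷ c k q₀ q)) (*-assoc (m₁ c q₀) (mult k q) (F (q₀ ∷ q)))))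
        (∑-scal (box k) (m₁ c q₀) (λ q → mult k q * F (q₀ ∷ q)))))

∑ₘ-∷-≤ : ∀ {l₀ c} l (F : Word → ℚ) → l₀ ≤ c →
  ∑ₘ (l₀ ∷ l) F ≡ ∑< (suc c) (λ q₀ → m₁ l₀ q₀ * ∑ₘ l (λ q → F (q₀ ∷ q)))
∑ₘ-∷-≤ {l₀} l F l₀≤c = trans (∑ₘ-∷ l₀ l F) (∑<-extend (λ q₀ → m₁ l₀ q₀ * ∑ₘ l (λ q → F (q₀ ∷ q))) l₀≤c
  (λ q₀ l₀<q₀ → m₁-vanish-* l₀<q₀ (∑ₘ l (λ q → F (q₀ ∷ q)))))

∑ₘ-∷-shift : ∀ c k (F : ℕ → Word → ℚ) →
  ∑ₘ (c ∷ k) (λ q → F (sum (c ∷ k) ∸ sum q) q)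
  ≡ ∑< (suc c) (λ q₀ → m₁ c q₀ * ∑ₘ k (λ q → F ((c ∸ q₀) ℕ.+ (sum k ∸ sum q)) (q₀ ∷ q)))
∑ₘ-∷-shift c k F = trans (∑ₘ-∷ c k (λ q → F (sum (c ∷ k) ∸ sum q) q)) (∑<-ext< (suc c) (λ q₀ q₀<1+c → cong (m₁ c q₀ *_)
  (∑ₘ-ext k (λ q ib → cong (λ n → F n (q₀ ∷ q)) ([m+n]∸[o+p]≡[m∸o]+[n∸p] (NP.≤-pred q₀<1+c) (InBox-sum ib))))))

∑ₘ-∑< : ∀ k n (w : ℕ → ℚ) (F : ℕ → Word → ℚ) →
  ∑ₘ k (λ l → ∑< n (λ i → w i * F i l)) ≡ ∑< n (λ i → w i * ∑ₘ k (F i))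
∑ₘ-∑< k n w F = begin
    ∑ (box k) (λ l → mult k l * ∑< n (λ i → w i * F i l))
  ≡⟨ ∑-ext (box k) (λ l → sym (∑<-scal n (mult k l) (λ i → w i * F i l))) ⟩
    ∑ (box k) (λ l → ∑< n (λ i → mult k l * (w i * F i l)))
  ≡⟨ ∑<-∑-swap n (box k) (λ i l → mult k l * (w i * F i l)) ⟨
    ∑< n (λ i → ∑ (box k) (λ l → mult k l * (w i * F i l)))
  ≡⟨ ∑<-ext n (λ i → trans (∑-ext (box k) (λ l → m*[w*x]≡w*[m*x] (mult k l) (w i) (F i l)))
                            (∑-scal (box k) (w i) (λ l → mult k l * F i l))) ⟩
    ∑< n (λ i → w i * ∑ₘ k (F i)) ∎
  where
  open ≡-Reasoning
  m*[w*x]≡w*[m*x] : ∀ m w x → m * (w * x) ≡ w * (m * x)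
  m*[w*x]≡w*[m*x] = solve 3 (λ m w x → m :* (w :* x) := w :* (m :* x)) refl

-- The multivariate identity behind the composition of the ari multiplicities; coordinatewise it is m₁-chain-collapse.
mult-chain-collapse : ∀ k a (E : ℕ → Word → ℚ) →
  ∑ₘ k (λ l → 𝕄 (suc a ℕ.+ (sum k ∸ sum l)) (λ j → ∑ₘ l (E j)))
  ≡ 𝕄 (suc a) (λ p → ∑ₘ k (λ q → E (p ℕ.+ (sum k ∸ sum q)) q))
mult-chain-collapse [] a E = begin
    1ℚ * 𝕄 (suc a ℕ.+ 0) (λ j → 1ℚ * E j [] + 0ℚ) + 0ℚ
  ≡⟨ solve 1 (λ x → con 1ℚ :* x :+ con 0ℚ := x) refl (𝕄 (suc a ℕ.+ 0) (λ j → 1ℚ * E j [] + 0ℚ)) ⟩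
    𝕄 (suc a ℕ.+ 0) (λ j → 1ℚ * E j [] + 0ℚ)
  ≡⟨ cong (λ b → 𝕄 b (λ j → 1ℚ * E j [] + 0ℚ)) (NP.+-identityʳ (suc a)) ⟩
    𝕄 (suc a) (λ j → 1ℚ * E j [] + 0ℚ)
  ≡⟨ 𝕄-ext (suc a) (λ p → cong (λ n → 1ℚ * E n [] + 0ℚ) (sym (NP.+-identityʳ p))) ⟩
    𝕄 (suc a) (λ p → 1ℚ * E (p ℕ.+ 0) [] + 0ℚ) ∎
  where open ≡-Reasoning
mult-chain-collapse (c ∷ k) a E = begin
    ∑ₘ (c ∷ k) (λ l → 𝕄 (suc a ℕ.+ (sum (c ∷ k) ∸ sum l)) (λ j → ∑ₘ l (E j)))
  ≡⟨ ∑ₘ-∷-shift c k (λ n l → 𝕄 (suc a ℕ.+ n) (λ j → ∑ₘ l (E j))) ⟩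
    ∑< (suc c) (λ l₀ → m₁ c l₀ * ∑ₘ k (λ l → 𝕄 (suc a ℕ.+ ((c ∸ l₀) ℕ.+ (sum k ∸ sum l))) (λ j → ∑ₘ (l₀ ∷ l) (E j))))
  ≡⟨ ∑<-ext< (suc c) (λ l₀ l₀<1+c → cong (m₁ c l₀ *_) (inner l₀ (NP.≤-pred l₀<1+c))) ⟩
    ∑< (suc c) (λ l₀ → m₁ c l₀ * ∑< (suc c) (λ q₀ → m₁ l₀ q₀ * 𝕄 (suc a ℕ.+ (c ∸ l₀)) (g q₀)))
  ≡⟨ ∑<-ext (suc c) (λ l₀ → sym (∑<-scal (suc c) (m₁ c l₀) (λ q₀ → m₁ l₀ q₀ * 𝕄 (suc a ℕ.+ (c ∸ l₀)) (g q₀)))) ⟩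
    ∑< (suc c) (λ l₀ → ∑< (suc c) (λ q₀ → m₁ c l₀ * (m₁ l₀ q₀ * 𝕄 (suc a ℕ.+ (c ∸ l₀)) (g q₀))))
  ≡⟨ ∑<-swap (suc c) (suc c) (λ l₀ q₀ → m₁ c l₀ * (m₁ l₀ q₀ * 𝕄 (suc a ℕ.+ (c ∸ l₀)) (g q₀))) ⟩
    ∑< (suc c) (λ q₀ → m₁-chain c q₀ a (g q₀))
  ≡⟨ ∑<-ext (suc c) (λ q₀ → m₁-chain-collapse c q₀ a (g q₀)) ⟩
    ∑< (suc c) (λ q₀ → m₁ c q₀ * 𝕄 (suc a) (λ p → g q₀ (p ℕ.+ (c ∸ q₀))))
  ≡⟨ 𝕄-∑< (suc a) (suc c) (m₁ c) (λ q₀ p → g q₀ (p ℕ.+ (c ∸ q₀))) ⟨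
    𝕄 (suc a) (λ p → ∑< (suc c) (λ q₀ → m₁ c q₀ * g q₀ (p ℕ.+ (c ∸ q₀))))
  ≡⟨ 𝕄-ext (suc a) (λ p → ∑<-ext (suc c) (λ q₀ → cong (m₁ c q₀ *_) (∑-ext (box k) (λ q →
       cong (λ n → mult k q * E n (q₀ ∷ q)) (NP.+-assoc p (c ∸ q₀) (sum k ∸ sum q)))))) ⟩
    𝕄 (suc a) (λ p → ∑< (suc c) (λ q₀ → m₁ c q₀ * ∑ₘ k (λ q → E (p ℕ.+ ((c ∸ q₀) ℕ.+ (sum k ∸ sum q))) (q₀ ∷ q))))
  ≡⟨ 𝕄-ext (suc a) (λ p → ∑ₘ-∷-shift c k (λ n q → E (p ℕ.+ n) q)) ⟨
    𝕄 (suc a) (λ p → ∑ₘ (c ∷ k) (λ q → E (p ℕ.+ (sum (c ∷ k) ∸ sum q)) q)) ∎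
  where
  open ≡-Reasoning
  g : ℕ → ℕ → ℚ
  g q₀ p = ∑ₘ k (λ q → E (p ℕ.+ (sum k ∸ sum q)) (q₀ ∷ q))
  inner : ∀ l₀ → l₀ ≤ c →
    ∑ₘ k (λ l → 𝕄 (suc a ℕ.+ ((c ∸ l₀) ℕ.+ (sum k ∸ sum l))) (λ j → ∑ₘ (l₀ ∷ l) (E j)))
    ≡ ∑< (suc c) (λ q₀ → m₁ l₀ q₀ * 𝕄 (suc a ℕ.+ (c ∸ l₀)) (g q₀))
  inner l₀ l₀≤c = begin
      ∑ₘ k (λ l → 𝕄 (suc a ℕ.+ ((c ∸ l₀) ℕ.+ (sum k ∸ sum l))) (λ j → ∑ₘ (l₀ ∷ l) (E j)))
    ≡⟨ ∑ₘ-ext k (λ l _ → trans (cong (λ b → 𝕄 (suc b) (λ j → ∑ₘ (l₀ ∷ l) (E j))) (sym (NP.+-assoc a (c ∸ l₀) (sum k ∸ sum l))))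
                                (𝕄-ext (suc (a ℕ.+ (c ∸ l₀)) ℕ.+ (sum k ∸ sum l)) (λ j → ∑ₘ-∷-≤ l (E j) l₀≤c))) ⟩
      ∑ₘ k (λ l → 𝕄 (suc (a ℕ.+ (c ∸ l₀)) ℕ.+ (sum k ∸ sum l)) (λ j → ∑< (suc c) (λ q₀ → m₁ l₀ q₀ * ∑ₘ l (λ q → E j (q₀ ∷ q)))))
    ≡⟨ ∑ₘ-ext k (λ l _ → 𝕄-∑< (suc (a ℕ.+ (c ∸ l₀)) ℕ.+ (sum k ∸ sum l)) (suc c) (m₁ l₀) (λ q₀ j → ∑ₘ l (λ q → E j (q₀ ∷ q)))) ⟩
      ∑ₘ k (λ l → ∑< (suc c) (λ q₀ → m₁ l₀ q₀ * 𝕄 (suc (a ℕ.+ (c ∸ l₀)) ℕ.+ (sum k ∸ sum l)) (λ j → ∑ₘ l (λ q → E j (q₀ ∷ q)))))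
    ≡⟨ ∑ₘ-∑< k (suc c) (m₁ l₀) (λ q₀ l → 𝕄 (suc (a ℕ.+ (c ∸ l₀)) ℕ.+ (sum k ∸ sum l)) (λ j → ∑ₘ l (λ q → E j (q₀ ∷ q)))) ⟩
      ∑< (suc c) (λ q₀ → m₁ l₀ q₀ * ∑ₘ k (λ l → 𝕄 (suc (a ℕ.+ (c ∸ l₀)) ℕ.+ (sum k ∸ sum l)) (λ j → ∑ₘ l (λ q → E j (q₀ ∷ q)))))
    ≡⟨ ∑<-ext (suc c) (λ q₀ → cong (m₁ l₀ q₀ *_) (mult-chain-collapse k (a ℕ.+ (c ∸ l₀)) (λ j q → E j (q₀ ∷ q)))) ⟩
      ∑< (suc c) (λ q₀ → m₁ l₀ q₀ * 𝕄 (suc a ℕ.+ (c ∸ l₀)) (g q₀)) ∎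

-- Brackets and the Jacobi identity

pair-bracket-wordʳ : ∀ (P : Poly) q G → pair (bracket P (wordP q)) G ≡ pair P (λ p → G (p ++ q)) + - pair P (λ p → G (q ++ p))
pair-bracket-wordʳ P q G = trans (pair-bracket P (wordP q) G) (cong₂ (λ x y → x + - y)
  (pair-ext P (λ p → pair-wordP q (λ v → G (p ++ v)))) (pair-wordP q (λ v → pair P (λ u → G (v ++ u)))))

pair-bracket-wordˡ : ∀ p (Q : Poly) G → pair (bracket (wordP p) Q) G ≡ pair Q (λ q → G (p ++ q)) + - pair Q (λ q → G (q ++ p))
pair-bracket-wordˡ p Q G = trans (pair-bracket (wordP p) Q G) (cong₂ (λ x y → x + - y)
  (pair-wordP p (λ u → pair Q (λ v → G (u ++ v)))) (pair-ext Q (λ q → pair-wordP p (λ u → G (q ++ u)))))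

pair-bracket-linearˡ : ∀ (P Q : Poly) G → pair (bracket P Q) G ≡ pair P (λ p → pair (bracket (wordP p) Q) G)
pair-bracket-linearˡ P Q G = sym (begin
    pair P (λ p → pair (bracket (wordP p) Q) G)
  ≡⟨ pair-ext P (λ p → pair-bracket-wordˡ p Q G) ⟩
    pair P (λ p → pair Q (λ q → G (p ++ q)) + - pair Q (λ q → G (q ++ p)))
  ≡⟨ pair-sub P (λ p → pair Q (λ q → G (p ++ q))) (λ p → pair Q (λ q → G (q ++ p))) ⟩
    pair P (λ p → pair Q (λ q → G (p ++ q))) + - pair P (λ p → pair Q (λ q → G (q ++ p)))
  ≡⟨ cong (λ z → pair P (λ p → pair Q (λ q → G (p ++ q))) + - z) (pair-swap P Q (λ p q → G (q ++ p))) ⟩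
    pair P (λ u → pair Q (λ v → G (u ++ v))) + - pair Q (λ v → pair P (λ u → G (v ++ u)))
  ≡⟨ sym (pair-bracket P Q G) ⟩
    pair (bracket P Q) G ∎)
  where open ≡-Reasoning

pair-bracket-linearʳ : ∀ (P Q : Poly) G → pair (bracket P Q) G ≡ pair Q (λ q → pair (bracket P (wordP q)) G)
pair-bracket-linearʳ P Q G = sym (begin
    pair Q (λ q → pair (bracket P (wordP q)) G)
  ≡⟨ pair-ext Q (λ q → pair-bracket-wordʳ P q G) ⟩
    pair Q (λ q → pair P (λ p → G (p ++ q)) + - pair P (λ p → G (q ++ p)))
  ≡⟨ pair-sub Q (λ q → pair P (λ p → G (p ++ q))) (λ q → pair P (λ p → G (q ++ p))) ⟩
    pair Q (λ q → pair P (λ p → G (p ++ q))) + - pair Q (λ q → pair P (λ p → G (q ++ p)))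
  ≡⟨ cong (_+ - pair Q (λ q → pair P (λ p → G (q ++ p)))) (pair-swap Q P (λ q p → G (p ++ q))) ⟩
    pair P (λ u → pair Q (λ v → G (u ++ v))) + - pair Q (λ v → pair P (λ u → G (v ++ u)))
  ≡⟨ sym (pair-bracket P Q G) ⟩
    pair (bracket P Q) G ∎)
  where open ≡-Reasoning

pair₃ : Poly → Poly → Poly → (Word → Word → Word → Word) → (Word → ℚ) → ℚ
pair₃ X Y Z f G = pair X (λ x → pair Y (λ y → pair Z (λ z → G (f x y z))))

pair₃-ext : ∀ X Y Z {f g : Word → Word → Word → Word} G → (∀ x y z → f x y z ≡ g x y z) → pair₃ X Y Z f G ≡ pair₃ X Y Z g G
pair₃-ext X Y Z G e = pair-ext X (λ x → pair-ext Y (λ y → pair-ext Z (λ z → cong G (e x y z))))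

pair₃-swap₂₃ : ∀ X Y Z (f : Word → Word → Word → Word) G → pair₃ X Z Y (λ x z y → f x y z) G ≡ pair₃ X Y Z f G
pair₃-swap₂₃ X Y Z f G = pair-ext X (λ x → pair-swap Z Y (λ z y → G (f x y z)))

pair-bracket-bracketˡ : ∀ X Y Z G → pair (bracket (bracket X Y) Z) G ≡
  (pair₃ X Y Z (λ x y z → (x ++ y) ++ z) G + - pair₃ X Y Z (λ x y z → (y ++ x) ++ z) G)
  + - (pair₃ X Y Z (λ x y z → z ++ (x ++ y)) G + - pair₃ X Y Z (λ x y z → z ++ (y ++ x)) G)
pair-bracket-bracketˡ X Y Z G = begin
    pair (bracket (bracket X Y) Z) G
  ≡⟨ pair-bracket (bracket X Y) Z G ⟩
    pair (bracket X Y) (λ u → pair Z (λ z → G (u ++ z))) + - pair Z (λ z → pair (bracket X Y) (λ u → G (z ++ u)))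
  ≡⟨ cong₂ (λ u v → u + - v) (pair-bracket X Y (λ u → pair Z (λ z → G (u ++ z))))
       (trans (pair-ext Z (λ z → pair-bracket X Y (λ u → G (z ++ u))))
         (pair-sub Z (λ z → pair X (λ x → pair Y (λ y → G (z ++ (x ++ y))))) (λ z → pair Y (λ y → pair X (λ x → G (z ++ (y ++ x))))))) ⟩
    (pair₃ X Y Z (λ x y z → (x ++ y) ++ z) G + - pair Y (λ y → pair X (λ x → pair Z (λ z → G ((y ++ x) ++ z)))))
      + - (pair Z (λ z → pair X (λ x → pair Y (λ y → G (z ++ (x ++ y))))) + - pair Z (λ z → pair Y (λ y → pair X (λ x → G (z ++ (y ++ x))))))
  ≡⟨ cong₂ (λ u v → (pair₃ X Y Z (λ x y z → (x ++ y) ++ z) G + - u) + - v) (pair-swap Y X (λ y x → pair Z (λ z → G ((y ++ x) ++ z))))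
       (cong₂ (λ u v → u + - v) (trans (pair-swap Z X (λ z x → pair Y (λ y → G (z ++ (x ++ y)))))
            (pair-ext X (λ x → pair-swap Z Y (λ z y → G (z ++ (x ++ y))))))
          (trans (pair-swap Z Y (λ z y → pair X (λ x → G (z ++ (y ++ x)))))
            (trans (pair-ext Y (λ y → pair-swap Z X (λ z x → G (z ++ (y ++ x))))) (pair-swap Y X (λ y x → pair Z (λ z → G (z ++ (y ++ x)))))))) ⟩
    (pair₃ X Y Z (λ x y z → (x ++ y) ++ z) G + - pair₃ X Y Z (λ x y z → (y ++ x) ++ z) G)
      + - (pair₃ X Y Z (λ x y z → z ++ (x ++ y)) G + - pair₃ X Y Z (λ x y z → z ++ (y ++ x)) G) ∎
  where open ≡-Reasoning

pair-bracket-bracketʳ : ∀ X Y Z G → pair (bracket X (bracket Y Z)) G ≡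
  (pair₃ X Y Z (λ x y z → x ++ (y ++ z)) G + - pair₃ X Y Z (λ x y z → x ++ (z ++ y)) G)
  + - (pair₃ X Y Z (λ x y z → (y ++ z) ++ x) G + - pair₃ X Y Z (λ x y z → (z ++ y) ++ x) G)
pair-bracket-bracketʳ X Y Z G = begin
    pair (bracket X (bracket Y Z)) G
  ≡⟨ pair-bracket X (bracket Y Z) G ⟩
    pair X (λ x → pair (bracket Y Z) (λ u → G (x ++ u))) + - pair (bracket Y Z) (λ u → pair X (λ x → G (u ++ x)))
  ≡⟨ cong₂ (λ u v → u + - v)
       (trans (pair-ext X (λ x → pair-bracket Y Z (λ u → G (x ++ u))))
          (pair-sub X (λ x → pair Y (λ y → pair Z (λ z → G (x ++ (y ++ z))))) (λ x → pair Z (λ z → pair Y (λ y → G (x ++ (z ++ y)))))))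
       (pair-bracket Y Z (λ u → pair X (λ x → G (u ++ x)))) ⟩
    (pair₃ X Y Z (λ x y z → x ++ (y ++ z)) G + - pair X (λ x → pair Z (λ z → pair Y (λ y → G (x ++ (z ++ y))))))
      + - (pair Y (λ y → pair Z (λ z → pair X (λ x → G ((y ++ z) ++ x)))) + - pair Z (λ z → pair Y (λ y → pair X (λ x → G ((z ++ y) ++ x)))))
  ≡⟨ cong₂ (λ u v → (pair₃ X Y Z (λ x y z → x ++ (y ++ z)) G + - u) + - v)
       (pair-ext X (λ x → pair-swap Z Y (λ z y → G (x ++ (z ++ y)))))
       (cong₂ (λ u v → u + - v)
         (trans (pair-ext Y (λ y → pair-swap Z X (λ z x → G ((y ++ z) ++ x)))) (pair-swap Y X (λ y x → pair Z (λ z → G ((y ++ z) ++ x)))))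
         (trans (pair-swap Z Y (λ z y → pair X (λ x → G ((z ++ y) ++ x))))
           (trans (pair-ext Y (λ y → pair-swap Z X (λ z x → G ((z ++ y) ++ x)))) (pair-swap Y X (λ y x → pair Z (λ z → G ((z ++ y) ++ x))))))) ⟩
    (pair₃ X Y Z (λ x y z → x ++ (y ++ z)) G + - pair₃ X Y Z (λ x y z → x ++ (z ++ y)) G)
      + - (pair₃ X Y Z (λ x y z → (y ++ z) ++ x) G + - pair₃ X Y Z (λ x y z → (z ++ y) ++ x) G) ∎
  where open ≡-Reasoning

-- Once both sides are expanded into the eight monomial orderings of v, a, b, the identity is associativity of ++.
jacobi : ∀ V A B G → pair (bracket (bracket V A) B) G + - pair (bracket (bracket V B) A) G ≡ pair (bracket V (bracket A B)) G
jacobi V A B G = begin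
    pair (bracket (bracket V A) B) G + - pair (bracket (bracket V B) A) G
  ≡⟨ cong₂ (λ x y → x + - y) (pair-bracket-bracketˡ V A B G) (trans (pair-bracket-bracketˡ V B A G) reorder) ⟩
    ((t (λ v a b → (v ++ a) ++ b) + - t (λ v a b → (a ++ v) ++ b)) + - (t (λ v a b → b ++ (v ++ a)) + - t (λ v a b → b ++ (a ++ v))))
    + - ((t (λ v a b → (v ++ b) ++ a) + - t (λ v a b → (b ++ v) ++ a)) + - (t (λ v a b → a ++ (v ++ b)) + - t (λ v a b → a ++ (b ++ v))))
  ≡⟨ cong₂ (λ x y → x + - y)
      (cong₂ (λ x y → x + - y) (cong₂ (λ x y → x + - y) (assoc (λ v a b → ++-assoc v a b)) (assoc (λ v a b → ++-assoc a v b)))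
          (cong (λ x → x + - t (λ v a b → b ++ (a ++ v))) (assoc (λ v a b → sym (++-assoc b v a)))))
      (cong (λ x → (x + - X₃) + - (X₂ + - X₆)) (assoc (λ v a b → ++-assoc v b a))) ⟩
    ((X₁ + - X₂) + - (X₃ + - X₄)) + - ((X₅ + - X₃) + - (X₂ + - X₆))
  ≡⟨ solve 6 (λ x₁ x₂ x₃ x₄ x₅ x₆ → ((x₁ :+ :- x₂) :+ :- (x₃ :+ :- x₄)) :+ :- ((x₅ :+ :- x₃) :+ :- (x₂ :+ :- x₆))
               := (x₁ :+ :- x₅) :+ :- (x₆ :+ :- x₄)) refl X₁ X₂ X₃ X₄ X₅ X₆ ⟩
    (X₁ + - X₅) + - (X₆ + - X₄)
  ≡⟨ cong (λ y → (X₁ + - X₅) + - y) (cong₂ (λ x y → x + - y) (assoc (λ v a b → sym (++-assoc a b v))) (assoc (λ v a b → sym (++-assoc b a v)))) ⟩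
    (t (λ v a b → v ++ (a ++ b)) + - t (λ v a b → v ++ (b ++ a))) + - (t (λ v a b → (a ++ b) ++ v) + - t (λ v a b → (b ++ a) ++ v))
  ≡⟨ pair-bracket-bracketʳ V A B G ⟨
    pair (bracket V (bracket A B)) G ∎
  where
  open ≡-Reasoning
  t : (Word → Word → Word → Word) → ℚ
  t f = pair₃ V A B f G
  assoc : ∀ {f g : Word → Word → Word → Word} → (∀ v a b → f v a b ≡ g v a b) → t f ≡ t g
  assoc = pair₃-ext V A B G
  reorder : (pair₃ V B A (λ v b a → (v ++ b) ++ a) G + - pair₃ V B A (λ v b a → (b ++ v) ++ a) G)
            + - (pair₃ V B A (λ v b a → a ++ (v ++ b)) G + - pair₃ V B A (λ v b a → a ++ (b ++ v)) G)
          ≡ (t (λ v a b → (v ++ b) ++ a) + - t (λ v a b → (b ++ v) ++ a)) + - (t (λ v a b → a ++ (v ++ b)) + - t (λ v a b → a ++ (b ++ v)))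
  reorder = cong₂ (λ x y → x + - y)
    (cong₂ (λ x y → x + - y) (pair₃-swap₂₃ V A B (λ v a b → (v ++ b) ++ a) G) (pair₃-swap₂₃ V A B (λ v a b → (b ++ v) ++ a) G))
    (cong₂ (λ x y → x + - y) (pair₃-swap₂₃ V A B (λ v a b → a ++ (v ++ b)) G) (pair₃-swap₂₃ V A B (λ v a b → a ++ (b ++ v)) G))
  X₁ = t (λ v a b → v ++ (a ++ b))
  X₂ = t (λ v a b → a ++ (v ++ b))
  X₃ = t (λ v a b → (b ++ v) ++ a)
  X₄ = t (λ v a b → b ++ (a ++ v))
  X₅ = t (λ v a b → v ++ (b ++ a))
  X₆ = t (λ v a b → a ++ (b ++ v))

-- Relabelling, right-nested brackets and Lie polynomials

InBox-split : ∀ A B {l} → InBox (A ++ B) l → Σ Word (λ la → Σ Word (λ lb → (l ≡ la ++ lb) × (InBox A la × InBox B lb)))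
InBox-split [] B ib = [] , _ , refl , ib[] , ib
InBox-split (c ∷ A) B (ib∷ {l0 = l0} x ib) with InBox-split A B ib
... | la , lb , refl , ia , ibb = (l0 ∷ la) , lb , refl , ib∷ x ia , ibb

relabel′-++ : ∀ t {l} → InBox (leaves t) l → ∀ rest → relabel′ t (l ++ rest) ≡ (relabel t l , rest)
relabel-⋆ : ∀ t u {la lb} → InBox (leaves t) la → InBox (leaves u) lb → relabel (t ⋆ u) (la ++ lb) ≡ relabel t la ⋆ relabel u lb

relabel′-++ (leaf k) (ib∷ _ ib[]) rest = refl
relabel′-++ (t ⋆ u) ib rest with InBox-split (leaves t) (leaves u) ib
... | la , lb , refl , ia , ibb =
  trans (cong (relabel′ (t ⋆ u)) (++-assoc la lb rest))
   (trans (cong (λ X → ((proj₁ X ⋆ proj₁ (relabel′ u (proj₂ X))) , proj₂ (relabel′ u (proj₂ X)))) (relabel′-++ t ia (lb ++ rest)))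
    (trans (cong (λ Y → ((relabel t la ⋆ proj₁ Y) , proj₂ Y)) (relabel′-++ u ibb rest))
      (cong (_, rest) (sym (relabel-⋆ t u ia ibb)))))

relabel-⋆ t u {la} {lb} ia ibb = trans (cong (λ X → proj₁ X ⋆ proj₁ (relabel′ u (proj₂ X))) (relabel′-++ t ia lb))
    (cong (λ Y → relabel t la ⋆ proj₁ Y) (trans (cong (relabel′ u) (sym (++-identityʳ lb))) (relabel′-++ u ibb [])))

rnest : Word → Poly → Poly
rnest [] V = V
rnest (x ∷ l) V = rnest l (bracket V (letterP x))

rnest-++ : ∀ l1 l2 V → rnest (l1 ++ l2) V ≡ rnest l2 (rnest l1 V)
rnest-++ [] l2 V = refl
rnest-++ (x ∷ l1) l2 V = rnest-++ l1 l2 (bracket V (letterP x))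

pair-rnest-linear : ∀ l V G → pair (rnest l V) G ≡ pair V (λ u → pair (rnest l (wordP u)) G)
pair-rnest-linear [] V G = sym (pair-ext V (λ u → pair-wordP u G))
pair-rnest-linear (x ∷ l) V G = trans (pair-rnest-linear l (bracket V (letterP x)) G)
  (trans (pair-bracket-linearˡ V (letterP x) (λ u → pair (rnest l (wordP u)) G))
    (pair-ext V (λ p → sym (pair-rnest-linear l (bracket (wordP p) (letterP x)) G))))

-- A property of every Lie polynomial (IsLie-treeP), used in place of membership in Lie(V).
IsLie : Poly → Set
IsLie P = ∀ V G → pair P (λ w → pair (rnest w V) G) ≡ pair (bracket V P) G

pair₂-rnest : ∀ {A B} → IsLie A → IsLie B → ∀ V G →
  pair A (λ a → pair B (λ b → pair (rnest (a ++ b) V) G)) ≡ pair (bracket (bracket V A) B) G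
pair₂-rnest {A} {B} LA LB V G = begin
    pair A (λ a → pair B (λ b → pair (rnest (a ++ b) V) G))
  ≡⟨ pair-ext A (λ a → trans (pair-ext B (λ b → cong (λ P → pair P G) (rnest-++ a b V)))
        (trans (LB (rnest a V) G) (pair-bracket-linearˡ (rnest a V) B G))) ⟩
    pair A (λ a → pair (rnest a V) (λ p → pair (bracket (wordP p) B) G))
  ≡⟨ LA V (λ p → pair (bracket (wordP p) B) G) ⟩
    pair (bracket V A) (λ p → pair (bracket (wordP p) B) G)
  ≡⟨ pair-bracket-linearˡ (bracket V A) B G ⟨
    pair (bracket (bracket V A) B) G ∎
  where open ≡-Reasoning

IsLie-bracket : ∀ {A B} → IsLie A → IsLie B → IsLie (bracket A B)
IsLie-bracket {A} {B} LA LB V G = begin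
    pair (bracket A B) (λ w → pair (rnest w V) G)
  ≡⟨ pair-bracket A B (λ w → pair (rnest w V) G) ⟩
    pair A (λ a → pair B (λ b → pair (rnest (a ++ b) V) G)) + - pair B (λ b → pair A (λ a → pair (rnest (b ++ a) V) G))
  ≡⟨ cong₂ (λ x y → x + - y) (pair₂-rnest LA LB V G) (pair₂-rnest LB LA V G) ⟩
    pair (bracket (bracket V A) B) G + - pair (bracket (bracket V B) A) G
  ≡⟨ jacobi V A B G ⟩
    pair (bracket V (bracket A B)) G ∎
  where open ≡-Reasoning

IsLie-treeP : ∀ t → IsLie (treeP t)
IsLie-treeP (leaf k) V G = pair-letterP k (λ w → pair (rnest w V) G)
IsLie-treeP (t ⋆ u)      = IsLie-bracket (IsLie-treeP t) (IsLie-treeP u)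

-- The multiplicity map Θ

Tagged : Set
Tagged = ℕ × Word

_⊙_ : Tagged → Tagged → Tagged
α ⊙ β = (proj₁ α ℕ.+ proj₁ β , proj₂ α ++ proj₂ β)

-- Θ v_k = Σ_l m_{k,l} (|k| - |l|, v_l): the ari multiplicities, with the weight that v_k loses recorded as a tag.
Θ : Word → List (ℚ × Tagged)
Θ k = map (λ l → (mult k l , (sum k ∸ sum l , l))) (box k)

pair-Θ : ∀ k (H : Tagged → ℚ) → pair (Θ k) H ≡ ∑ₘ k (λ l → H (sum k ∸ sum l , l))
pair-Θ k H = pair-map (λ l → (mult k l , (sum k ∸ sum l , l))) (box k) H

∑ₘ-sub : ∀ k (F G : Word → ℚ) → ∑ₘ k (λ l → F l + - G l) ≡ ∑ₘ k F + - ∑ₘ k G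
∑ₘ-sub k F G = trans (∑-ext (box k) (λ l → solve 3 (λ m x y → m :* (x :+ :- y) := m :* x :+ :- (m :* y)) refl (mult k l) (F l) (G l)))
  (trans (∑-add (box k) (λ l → mult k l * F l) (λ l → - (mult k l * G l))) (cong (∑ₘ k F +_) (∑-neg (box k) (λ l → mult k l * G l))))

∑ₘ-swap : ∀ k k′ (F : Word → Word → ℚ) → ∑ₘ k (λ l → ∑ₘ k′ (F l)) ≡ ∑ₘ k′ (λ l′ → ∑ₘ k (λ l → F l l′))
∑ₘ-swap k k′ F = begin
    ∑ (box k) (λ l → mult k l * ∑ (box k′) (λ l′ → mult k′ l′ * F l l′))
  ≡⟨ ∑-ext (box k) (λ l → sym (∑-scal (box k′) (mult k l) (λ l′ → mult k′ l′ * F l l′))) ⟩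
    ∑ (box k) (λ l → ∑ (box k′) (λ l′ → mult k l * (mult k′ l′ * F l l′)))
  ≡⟨ ∑-swap (box k) (box k′) (λ l l′ → mult k l * (mult k′ l′ * F l l′)) ⟩
    ∑ (box k′) (λ l′ → ∑ (box k) (λ l → mult k l * (mult k′ l′ * F l l′)))
  ≡⟨ ∑-ext (box k′) (λ l′ → trans (∑-ext (box k) (λ l → m*[m′*x]≡m′*[m*x] (mult k l) (mult k′ l′) (F l l′)))
                                  (∑-scal (box k) (mult k′ l′) (λ l → mult k l * F l l′))) ⟩
    ∑ (box k′) (λ l′ → mult k′ l′ * ∑ (box k) (λ l → mult k l * F l l′)) ∎
  where
  open ≡-Reasoning
  m*[m′*x]≡m′*[m*x] : ∀ m m′ x → m * (m′ * x) ≡ m′ * (m * x)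
  m*[m′*x]≡m′*[m*x] = solve 3 (λ m m′ x → m :* (m′ :* x) := m′ :* (m :* x)) refl

pair-∑ₘ : (P : List (ℚ × I)) (k : Word) (F : I → Word → ℚ) → pair P (λ a → ∑ₘ k (F a)) ≡ ∑ₘ k (λ l → pair P (λ a → F a l))
pair-∑ₘ P k F = trans (pair-∑ P (box k) (λ a l → mult k l * F a l)) (∑-ext (box k) (λ l → pair-scal P (mult k l) (λ a → F a l)))

∑ₘ-++ : ∀ u v (F : Word → ℚ) → ∑ₘ (u ++ v) F ≡ ∑ₘ u (λ l₁ → ∑ₘ v (λ l₂ → F (l₁ ++ l₂)))
∑ₘ-++ u v F = trans (∑-box-++ u v (λ l → mult (u ++ v) l * F l)) (∑-box-ext u (λ l₁ ib₁ →
  trans (∑-ext (box v) (λ l₂ → trans (cong (_* F (l₁ ++ l₂)) (mult-++ ib₁ v l₂)) (*-assoc (mult u l₁) (mult v l₂) (F (l₁ ++ l₂)))))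
        (∑-scal (box v) (mult u l₁) (λ l₂ → mult v l₂ * F (l₁ ++ l₂)))))

∑ₘ-++-shift : ∀ u v (F : ℕ → Word → ℚ) →
  ∑ₘ (u ++ v) (λ l → F (sum (u ++ v) ∸ sum l) l)
  ≡ ∑ₘ u (λ l₁ → ∑ₘ v (λ l₂ → F ((sum u ∸ sum l₁) ℕ.+ (sum v ∸ sum l₂)) (l₁ ++ l₂)))
∑ₘ-++-shift u v F = trans (∑ₘ-++ u v (λ l → F (sum (u ++ v) ∸ sum l) l)) (∑ₘ-ext u (λ l₁ ib₁ → ∑ₘ-ext v (λ l₂ ib₂ →
  cong (λ n → F n (l₁ ++ l₂)) (trans (cong₂ _∸_ (sum-++ u v) (sum-++ l₁ l₂)) ([m+n]∸[o+p]≡[m∸o]+[n∸p] (InBox-sum ib₁) (InBox-sum ib₂))))))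

Θ-++ : ∀ u v (H : Tagged → ℚ) → pair (Θ (u ++ v)) H ≡ pair (Θ u) (λ α → pair (Θ v) (λ β → H (α ⊙ β)))
Θ-++ u v H = begin
    pair (Θ (u ++ v)) H
  ≡⟨ pair-Θ (u ++ v) H ⟩
    ∑ₘ (u ++ v) (λ l → H (sum (u ++ v) ∸ sum l , l))
  ≡⟨ ∑ₘ-++-shift u v (λ n l → H (n , l)) ⟩
    ∑ₘ u (λ l₁ → ∑ₘ v (λ l₂ → H ((sum u ∸ sum l₁) ℕ.+ (sum v ∸ sum l₂) , l₁ ++ l₂)))
  ≡⟨ trans (pair-Θ u (λ α → pair (Θ v) (λ β → H (α ⊙ β))))
           (∑ₘ-ext u (λ l₁ _ → pair-Θ v (λ β → H ((sum u ∸ sum l₁ , l₁) ⊙ β)))) ⟨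
    pair (Θ u) (λ α → pair (Θ v) (λ β → H (α ⊙ β))) ∎
  where open ≡-Reasoning

pairΘ : Poly → (Tagged → ℚ) → ℚ
pairΘ P H = pair P (λ w → pair (Θ w) H)

pairΘ-bracket : ∀ A B H →
  pairΘ (bracket A B) H ≡ pairΘ A (λ α → pairΘ B (λ β → H (α ⊙ β))) + - pairΘ B (λ β → pairΘ A (λ α → H (β ⊙ α)))
pairΘ-bracket A B H = trans (pair-bracket A B (λ w → pair (Θ w) H)) (cong₂ (λ x y → x + - y) (Θ-pair-pair A B) (Θ-pair-pair B A))
  where
  Θ-pair-pair : ∀ X Y → pair X (λ x → pair Y (λ y → pair (Θ (x ++ y)) H)) ≡ pairΘ X (λ α → pairΘ Y (λ β → H (α ⊙ β)))
  Θ-pair-pair X Y = pair-ext X (λ x → trans (pair-ext Y (λ y → Θ-++ x y H))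
                                            (pair-swap Y (Θ x) (λ y α → pair (Θ y) (λ β → H (α ⊙ β)))))

ΘExpansion : Tree → Set
ΘExpansion t = ∀ H → pairΘ (treeP t) H ≡ ∑ₘ (leaves t) (λ l → pair (treeP (relabel t l)) (λ w → H (sum (leaves t) ∸ sum l , w)))

pairΘ-nested : ∀ t u → ΘExpansion t → ΘExpansion u → ∀ (K : Tagged → Tagged → ℚ) →
  pairΘ (treeP t) (λ α → pairΘ (treeP u) (K α))
  ≡ ∑ₘ (leaves t) (λ l₁ → ∑ₘ (leaves u) (λ l₂ → pair (treeP (relabel t l₁)) (λ a → pair (treeP (relabel u l₂)) (λ b →
        K (sum (leaves t) ∸ sum l₁ , a) (sum (leaves u) ∸ sum l₂ , b)))))
pairΘ-nested t u Θt Θu K = begin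
    pairΘ (treeP t) (λ α → pairΘ (treeP u) (K α))
  ≡⟨ pair-ext (treeP t) (λ a → pair-ext (Θ a) (λ α → Θu (K α))) ⟩
    pairΘ (treeP t) (λ α → ∑ₘ (leaves u) (λ l₂ → pair (treeP (relabel u l₂)) (λ b → K α (sum (leaves u) ∸ sum l₂ , b))))
  ≡⟨ Θt (λ α → ∑ₘ (leaves u) (λ l₂ → pair (treeP (relabel u l₂)) (λ b → K α (sum (leaves u) ∸ sum l₂ , b)))) ⟩
    ∑ₘ (leaves t) (λ l₁ → pair (treeP (relabel t l₁)) (λ a →
      ∑ₘ (leaves u) (λ l₂ → pair (treeP (relabel u l₂)) (λ b → K (sum (leaves t) ∸ sum l₁ , a) (sum (leaves u) ∸ sum l₂ , b)))))
  ≡⟨ ∑ₘ-ext (leaves t) (λ l₁ _ → pair-∑ₘ (treeP (relabel t l₁)) (leaves u)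
       (λ a l₂ → pair (treeP (relabel u l₂)) (λ b → K (sum (leaves t) ∸ sum l₁ , a) (sum (leaves u) ∸ sum l₂ , b)))) ⟩
    ∑ₘ (leaves t) (λ l₁ → ∑ₘ (leaves u) (λ l₂ → pair (treeP (relabel t l₁)) (λ a → pair (treeP (relabel u l₂)) (λ b →
        K (sum (leaves t) ∸ sum l₁ , a) (sum (leaves u) ∸ sum l₂ , b))))) ∎
  where open ≡-Reasoning

-- Θ is multiplicative (Θ-++), so on a Lie monomial it acts by relabelling the leaves.
Θ-treeP : ∀ t → ΘExpansion t
Θ-treeP (leaf k) H = trans (pair-letterP k (λ w → pair (Θ w) H)) (trans (pair-Θ (k ∷ []) H)
  (∑ₘ-ext (k ∷ []) (λ { (l ∷ []) (ib∷ _ ib[]) → sym (pair-letterP l (λ w → H (sum (k ∷ []) ∸ sum (l ∷ []) , w))) })))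
Θ-treeP (t ⋆ u) H = begin
    pairΘ (bracket (treeP t) (treeP u)) H
  ≡⟨ pairΘ-bracket (treeP t) (treeP u) H ⟩
    pairΘ (treeP t) (λ α → pairΘ (treeP u) (λ β → H (α ⊙ β))) + - pairΘ (treeP u) (λ β → pairΘ (treeP t) (λ α → H (β ⊙ α)))
  ≡⟨ cong₂ (λ x y → x + - y) (pairΘ-nested t u (Θ-treeP t) (Θ-treeP u) (λ α β → H (α ⊙ β)))
       (trans (pairΘ-nested u t (Θ-treeP u) (Θ-treeP t) (λ β α → H (β ⊙ α)))
         (trans (∑ₘ-swap (leaves u) (leaves t) (λ l₂ l₁ → pair (Tu l₂) (λ b → pair (Tt l₁) (λ a → H ((sum (leaves u) ∸ sum l₂) ℕ.+ (sum (leaves t) ∸ sum l₁) , b ++ a)))))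
           (∑ₘ-ext (leaves t) (λ l₁ _ → ∑ₘ-ext (leaves u) (λ l₂ _ → pair-ext (Tu l₂) (λ b → pair-ext (Tt l₁) (λ a →
              cong (λ n → H (n , b ++ a)) (NP.+-comm (sum (leaves u) ∸ sum l₂) (sum (leaves t) ∸ sum l₁))))))))) ⟩
    ∑ₘ (leaves t) (λ l₁ → ∑ₘ (leaves u) (P₁ l₁)) + - ∑ₘ (leaves t) (λ l₁ → ∑ₘ (leaves u) (P₂ l₁))
  ≡⟨ trans (∑ₘ-ext (leaves t) (λ l₁ _ → ∑ₘ-sub (leaves u) (P₁ l₁) (P₂ l₁)))
           (∑ₘ-sub (leaves t) (λ l₁ → ∑ₘ (leaves u) (P₁ l₁)) (λ l₁ → ∑ₘ (leaves u) (P₂ l₁))) ⟨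
    ∑ₘ (leaves t) (λ l₁ → ∑ₘ (leaves u) (λ l₂ → P₁ l₁ l₂ + - P₂ l₁ l₂))
  ≡⟨ ∑ₘ-ext (leaves t) (λ l₁ ib₁ → ∑ₘ-ext (leaves u) (λ l₂ ib₂ →
       trans (cong (λ T → pair (treeP T) (λ w → H (N l₁ l₂ , w))) (relabel-⋆ t u ib₁ ib₂))
             (pair-bracket (Tt l₁) (Tu l₂) (λ w → H (N l₁ l₂ , w))))) ⟨
    ∑ₘ (leaves t) (λ l₁ → ∑ₘ (leaves u) (λ l₂ → pair (treeP (relabel (t ⋆ u) (l₁ ++ l₂))) (λ w → H (N l₁ l₂ , w))))
  ≡⟨ ∑ₘ-++-shift (leaves t) (leaves u) (λ n l → pair (treeP (relabel (t ⋆ u) l)) (λ w → H (n , w))) ⟨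
    ∑ₘ (leaves (t ⋆ u)) (λ l → pair (treeP (relabel (t ⋆ u) l)) (λ w → H (sum (leaves (t ⋆ u)) ∸ sum l , w))) ∎
  where
  open ≡-Reasoning
  Tt Tu : Word → Poly
  Tt l₁ = treeP (relabel t l₁)
  Tu l₂ = treeP (relabel u l₂)
  N : Word → Word → ℕ
  N l₁ l₂ = (sum (leaves t) ∸ sum l₁) ℕ.+ (sum (leaves u) ∸ sum l₂)
  P₁ P₂ : Word → Word → ℚ
  P₁ l₁ l₂ = pair (Tt l₁) (λ a → pair (Tu l₂) (λ b → H (N l₁ l₂ , a ++ b)))
  P₂ l₁ l₂ = pair (Tu l₂) (λ b → pair (Tt l₁) (λ a → H (N l₁ l₂ , b ++ a)))

-- The derivation X ▷ _

linExt : (I → Poly) → List (ℚ × I) → Poly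
linExt f xs = concatMap (λ x → scaleP (proj₁ x) (f (proj₂ x))) xs

pair-linExt : ∀ (f : I → Poly) xs G → pair (linExt f xs) G ≡ pair xs (λ i → pair (f i) G)
pair-linExt f xs G = trans (pair-concatMap (λ x → scaleP (proj₁ x) (f (proj₂ x))) xs G)
  (trans (∑-ext xs (λ x → pair-scaleP (proj₁ x) (f (proj₂ x)) G)) (sym (pair≡∑ xs (λ i → pair (f i) G))))

bracketLetter : ℕ → Tagged → Poly
bracketLetter a α = bracket (letterP (a ℕ.+ proj₁ α)) (wordP (proj₂ α))

-- For X ∈ Lie(V) and a ≥ 1, Ψ a X is X ▷ v_a: each word k of X contributes Σ_l m_{k,l} [v_{a+|k|-|l|}, v_l].
Ψ : ℕ → Poly → Poly
Ψ a X = linExt (λ k → linExt (bracketLetter a) (Θ k)) X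

pair-Ψ : ∀ a X F → pair (Ψ a X) F ≡ pair X (λ k → pair (Θ k) (λ α → pair (bracketLetter a α) F))
pair-Ψ a X F = trans (pair-linExt (λ k → linExt (bracketLetter a) (Θ k)) X F)
  (pair-ext X (λ k → pair-linExt (bracketLetter a) (Θ k) F))

-- D X is the derivation of Q⟨V⟩ with D X v₀ = 0 and D X v_a = Ψ a X (a ≥ 1), that is, y ↦ X ▷ y.
Dₗ : Poly → ℕ → Poly
Dₗ X zero = []
Dₗ X (suc a) = Ψ (suc a) X

D : Poly → Word → Poly
D X [] = []
D X (a ∷ w) = (Dₗ X a *ₚ wordP w) +ₚ (letterP a *ₚ D X w)

pair-D-∷ : ∀ X a w G → pair (D X (a ∷ w)) G ≡ pair (Dₗ X a) (λ z → G (z ++ w)) + pair (D X w) (λ z → G (a ∷ z))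
pair-D-∷ X a w G = trans (pair-++ (Dₗ X a *ₚ wordP w) (letterP a *ₚ D X w) G)
  (cong₂ _+_ (trans (pair-*ₚ (Dₗ X a) (wordP w) G) (pair-ext (Dₗ X a) (λ u → pair-wordP w (λ v → G (u ++ v)))))
             (trans (pair-*ₚ (letterP a) (D X w) G) (pair-letterP a (λ u → pair (D X w) (λ v → G (u ++ v))))))

pair-D-letter : ∀ X a G → pair (D X (a ∷ [])) G ≡ pair (Dₗ X a) G
pair-D-letter X a G = trans (pair-D-∷ X a [] G) (trans (+-identityʳ (pair (Dₗ X a) (λ z → G (z ++ []))))
  (pair-ext (Dₗ X a) (λ z → cong G (++-identityʳ z))))

pair-D-++ : ∀ X a b G → pair (D X (a ++ b)) G ≡ pair (D X a) (λ z → G (z ++ b)) + pair (D X b) (λ z → G (a ++ z))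
pair-D-++ X [] b G = sym (+-identityˡ (pair (D X b) G))
pair-D-++ X (x ∷ a) b G = begin
    pair (D X (x ∷ (a ++ b))) G
  ≡⟨ pair-D-∷ X x (a ++ b) G ⟩
    pair (Dₗ X x) (λ z → G (z ++ (a ++ b))) + pair (D X (a ++ b)) (λ z → G (x ∷ z))
  ≡⟨ cong (pair (Dₗ X x) (λ z → G (z ++ (a ++ b))) +_) (pair-D-++ X a b (λ z → G (x ∷ z))) ⟩
    pair (Dₗ X x) (λ z → G (z ++ (a ++ b))) + (pair (D X a) (λ z → G (x ∷ (z ++ b))) + pair (D X b) (λ z → G (x ∷ (a ++ z))))
  ≡⟨ +-assoc (pair (Dₗ X x) (λ z → G (z ++ (a ++ b)))) (pair (D X a) (λ z → G (x ∷ (z ++ b)))) (pair (D X b) (λ z → G (x ∷ (a ++ z)))) ⟨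
    (pair (Dₗ X x) (λ z → G (z ++ (a ++ b))) + pair (D X a) (λ z → G (x ∷ (z ++ b)))) + pair (D X b) (λ z → G (x ∷ (a ++ z)))
  ≡⟨ cong (_+ pair (D X b) (λ z → G (x ∷ (a ++ z)))) (sym (trans (pair-D-∷ X x a (λ z → G (z ++ b)))
       (cong (_+ pair (D X a) (λ z → G (x ∷ (z ++ b)))) (pair-ext (Dₗ X x) (λ z → cong G (++-assoc z a b)))))) ⟩
    pair (D X (x ∷ a)) (λ z → G (z ++ b)) + pair (D X b) (λ z → G (x ∷ (a ++ z))) ∎
  where open ≡-Reasoning

pair₂-D-++ : ∀ X A B G → pair A (λ a → pair B (λ b → pair (D X (a ++ b)) G))
  ≡ pair A (λ a → pair B (λ b → pair (D X a) (λ z → G (z ++ b)))) + pair A (λ a → pair B (λ b → pair (D X b) (λ z → G (a ++ z))))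
pair₂-D-++ X A B G = trans (pair-ext A (λ a → trans (pair-ext B (λ b → pair-D-++ X a b G))
                                                    (pair-add B (λ b → pair (D X a) (λ z → G (z ++ b))) (λ b → pair (D X b) (λ z → G (a ++ z))))))
                           (pair-add A (λ a → pair B (λ b → pair (D X a) (λ z → G (z ++ b)))) (λ a → pair B (λ b → pair (D X b) (λ z → G (a ++ z)))))

pair-D-bracket : ∀ X P Q G →
  pair P (λ a → pair (D X a) (λ p → pair (bracket (wordP p) Q) G)) + pair Q (λ b → pair (D X b) (λ q → pair (bracket P (wordP q)) G))
  ≡ pair (bracket P Q) (λ z → pair (D X z) G)
pair-D-bracket X P Q G = begin
    pair P (λ a → pair (D X a) (λ p → pair (bracket (wordP p) Q) G)) + pair Q (λ b → pair (D X b) (λ q → pair (bracket P (wordP q)) G))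
  ≡⟨ cong₂ _+_ (trans (pair-ext P (λ a → trans (pair-ext (D X a) (λ p → pair-bracket-wordˡ p Q G))
                   (trans (pair-sub (D X a) (λ p → pair Q (λ b → G (p ++ b))) (λ p → pair Q (λ b → G (b ++ p))))
                     (cong₂ (λ x y → x + - y) (pair-swap (D X a) Q (λ p b → G (p ++ b))) (pair-swap (D X a) Q (λ p b → G (b ++ p)))))))
                 (pair-sub P (λ a → pair Q (λ b → pair (D X a) (λ p → G (p ++ b)))) (λ a → pair Q (λ b → pair (D X a) (λ p → G (b ++ p))))))
               (trans (pair-ext Q (λ b → trans (pair-ext (D X b) (λ q → pair-bracket-wordʳ P q G))
                   (trans (pair-sub (D X b) (λ q → pair P (λ a → G (a ++ q))) (λ q → pair P (λ a → G (q ++ a))))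
                     (cong₂ (λ x y → x + - y) (pair-swap (D X b) P (λ q a → G (a ++ q))) (pair-swap (D X b) P (λ q a → G (q ++ a)))))))
                 (pair-sub Q (λ b → pair P (λ a → pair (D X b) (λ q → G (a ++ q)))) (λ b → pair P (λ a → pair (D X b) (λ q → G (q ++ a)))))) ⟩
    (x₁ + - x₂) + (x₃ + - x₄)
  ≡⟨ solve 4 (λ x₁ x₂ x₃ x₄ → (x₁ :+ :- x₂) :+ (x₃ :+ :- x₄) := (x₁ :+ x₃) :+ :- (x₄ :+ x₂)) refl x₁ x₂ x₃ x₄ ⟩
    (x₁ + x₃) + - (x₄ + x₂)
  ≡⟨ cong₂ (λ p q → (x₁ + p) + - (x₄ + q)) (sym (pair-swap P Q (λ a b → pair (D X b) (λ z → G (a ++ z)))))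
                                           (sym (pair-swap Q P (λ b a → pair (D X a) (λ z → G (b ++ z))))) ⟩
    (pair P (λ a → pair Q (λ b → pair (D X a) (λ z → G (z ++ b)))) + pair P (λ a → pair Q (λ b → pair (D X b) (λ z → G (a ++ z)))))
      + - (pair Q (λ b → pair P (λ a → pair (D X b) (λ z → G (z ++ a)))) + pair Q (λ b → pair P (λ a → pair (D X a) (λ z → G (b ++ z)))))
  ≡⟨ cong₂ (λ p q → p + - q) (pair₂-D-++ X P Q G) (pair₂-D-++ X Q P G) ⟨
    pair P (λ a → pair Q (λ b → pair (D X (a ++ b)) G)) + - pair Q (λ b → pair P (λ a → pair (D X (b ++ a)) G))
  ≡⟨ pair-bracket P Q (λ z → pair (D X z) G) ⟨
    pair (bracket P Q) (λ z → pair (D X z) G) ∎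
  where
  open ≡-Reasoning
  x₁ = pair P (λ a → pair Q (λ b → pair (D X a) (λ p → G (p ++ b))))
  x₂ = pair P (λ a → pair Q (λ b → pair (D X a) (λ p → G (b ++ p))))
  x₃ = pair Q (λ b → pair P (λ a → pair (D X b) (λ q → G (a ++ q))))
  x₄ = pair Q (λ b → pair P (λ a → pair (D X b) (λ q → G (q ++ a))))

pairΘ-ext : ∀ X {H H′ : Tagged → ℚ} → (∀ α → H α ≡ H′ α) → pairΘ X H ≡ pairΘ X H′
pairΘ-ext X e = pair-ext X (λ k → pair-ext (Θ k) e)

pairΘ-sub : ∀ X (H H′ : Tagged → ℚ) → pairΘ X (λ α → H α + - H′ α) ≡ pairΘ X H + - pairΘ X H′
pairΘ-sub X H H′ = trans (pair-ext X (λ k → pair-sub (Θ k) H H′)) (pair-sub X (λ k → pair (Θ k) H) (λ k → pair (Θ k) H′))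

-- Through Θ, each word of a Lie polynomial behaves like a Lie element (IsLie), uniformly in the tag.
IsLieΘ : Poly → Set
IsLieΘ X = ∀ (V : ℕ → Poly) (G : ℕ → Word → ℚ) →
  pairΘ X (λ α → pair (rnest (proj₂ α) (V (proj₁ α))) (G (proj₁ α)))
  ≡ pairΘ X (λ α → pair (bracket (V (proj₁ α)) (wordP (proj₂ α))) (G (proj₁ α)))

IsLieΘ-treeP : ∀ t → IsLieΘ (treeP t)
IsLieΘ-treeP t V G = trans (Θ-treeP t (λ α → pair (rnest (proj₂ α) (V (proj₁ α))) (G (proj₁ α))))
  (trans (∑ₘ-ext (leaves t) (λ l _ →
     trans (IsLie-treeP (relabel t l) (V (sum (leaves t) ∸ sum l)) (G (sum (leaves t) ∸ sum l)))
           (pair-bracket-linearʳ (V (sum (leaves t) ∸ sum l)) (treeP (relabel t l)) (G (sum (leaves t) ∸ sum l)))))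
   (sym (Θ-treeP t (λ α → pair (bracket (V (proj₁ α)) (wordP (proj₂ α))) (G (proj₁ α))))))

IsLieΘ-lieP : ∀ x → IsLieΘ (lieP x)
IsLieΘ-lieP x V G = trans (pair-lieP x _) (trans (pair-ext x (λ t → IsLieΘ-treeP t V G)) (sym (pair-lieP x _)))

pair-bracketLetter : ∀ a α F → pair (bracketLetter a α) F ≡ F ((a ℕ.+ proj₁ α) ∷ proj₂ α) + - F (proj₂ α ++ ((a ℕ.+ proj₁ α) ∷ []))
pair-bracketLetter a α F = trans (pair-bracket-wordʳ (letterP (a ℕ.+ proj₁ α)) (proj₂ α) F)
  (cong₂ (λ x y → x + - y) (pair-letterP (a ℕ.+ proj₁ α) (λ p → F (p ++ proj₂ α))) (pair-letterP (a ℕ.+ proj₁ α) (λ p → F (proj₂ α ++ p))))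

pair-bracketLetter-rnest : ∀ a α V G →
  pair (bracketLetter a α) (λ w → pair (rnest w V) G)
  ≡ pair (rnest (proj₂ α) (bracket V (letterP (a ℕ.+ proj₁ α)))) G
    + - pair (rnest (proj₂ α) V) (λ p → pair (bracket (wordP p) (letterP (a ℕ.+ proj₁ α))) G)
pair-bracketLetter-rnest a α V G = trans (pair-bracketLetter a α (λ w → pair (rnest w V) G))
  (cong (λ x → pair (rnest (proj₂ α) (bracket V (letterP (a ℕ.+ proj₁ α)))) G + - x)
    (trans (cong (λ P → pair P G) (rnest-++ (proj₂ α) ((a ℕ.+ proj₁ α) ∷ []) V))
           (pair-bracket-linearˡ (rnest (proj₂ α) V) (letterP (a ℕ.+ proj₁ α)) G)))

jacobi-letter-word : ∀ V j l G →
  pair (bracket (bracket V (letterP j)) (wordP l)) G + - pair (bracket V (wordP l)) (λ p → pair (bracket (wordP p) (letterP j)) G)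
  ≡ pair (bracket (letterP j) (wordP l)) (λ q → pair (bracket V (wordP q)) G)
jacobi-letter-word V j l G = trans (cong (λ x → pair (bracket (bracket V (letterP j)) (wordP l)) G + - x)
                                         (sym (pair-bracket-linearˡ (bracket V (wordP l)) (letterP j) G)))
  (trans (jacobi V (letterP j) (wordP l) G) (pair-bracket-linearʳ V (bracket (letterP j) (wordP l)) G))

pair-bracket-[] : ∀ V G → pair (bracket V []) G ≡ 0ℚ
pair-bracket-[] V G = trans (pair-bracket V [] G) (cong (_+ - 0ℚ) (pair-zero V))

IsLie-Dₗ : ∀ x a → IsLie (Dₗ (lieP x) a)
IsLie-Dₗ x zero V G = sym (pair-bracket-[] V G)
IsLie-Dₗ x (suc a) V G = begin
    pair (Ψ (suc a) X) (λ w → pair (rnest w V) G)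
  ≡⟨ pair-Ψ (suc a) X (λ w → pair (rnest w V) G) ⟩
    pairΘ X (λ α → pair (bracketLetter (suc a) α) (λ w → pair (rnest w V) G))
  ≡⟨ pairΘ-ext X (λ α → pair-bracketLetter-rnest (suc a) α V G) ⟩
    pairΘ X (λ α → pair (rnest (proj₂ α) (V₁ (proj₁ α))) G + - pair (rnest (proj₂ α) V) (G₂ (proj₁ α)))
  ≡⟨ pairΘ-sub X (λ α → pair (rnest (proj₂ α) (V₁ (proj₁ α))) G) (λ α → pair (rnest (proj₂ α) V) (G₂ (proj₁ α))) ⟩
    pairΘ X (λ α → pair (rnest (proj₂ α) (V₁ (proj₁ α))) G) + - pairΘ X (λ α → pair (rnest (proj₂ α) V) (G₂ (proj₁ α)))
  ≡⟨ cong₂ (λ u v → u + - v) (IsLieΘ-lieP x V₁ (λ _ → G)) (IsLieΘ-lieP x (λ _ → V) G₂) ⟩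
    pairΘ X (λ α → pair (bracket (V₁ (proj₁ α)) (wordP (proj₂ α))) G) + - pairΘ X (λ α → pair (bracket V (wordP (proj₂ α))) (G₂ (proj₁ α)))
  ≡⟨ pairΘ-sub X (λ α → pair (bracket (V₁ (proj₁ α)) (wordP (proj₂ α))) G) (λ α → pair (bracket V (wordP (proj₂ α))) (G₂ (proj₁ α))) ⟨
    pairΘ X (λ α → pair (bracket (V₁ (proj₁ α)) (wordP (proj₂ α))) G + - pair (bracket V (wordP (proj₂ α))) (G₂ (proj₁ α)))
  ≡⟨ pairΘ-ext X (λ α → jacobi-letter-word V (suc a ℕ.+ proj₁ α) (proj₂ α) G) ⟩
    pairΘ X (λ α → pair (bracketLetter (suc a) α) (λ q → pair (bracket V (wordP q)) G))
  ≡⟨ pair-Ψ (suc a) X (λ q → pair (bracket V (wordP q)) G) ⟨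
    pair (Ψ (suc a) X) (λ q → pair (bracket V (wordP q)) G)
  ≡⟨ pair-bracket-linearʳ V (Ψ (suc a) X) G ⟨
    pair (bracket V (Ψ (suc a) X)) G ∎
  where
  open ≡-Reasoning
  X = lieP x
  V₁ : ℕ → Poly
  V₁ n = bracket V (letterP (suc a ℕ.+ n))
  G₂ : ℕ → Word → ℚ
  G₂ n p = pair (bracket (wordP p) (letterP (suc a ℕ.+ n))) G

pair-Dₗ-linear : ∀ x a F → pair (Dₗ (lieP x) a) F ≡ pair x (λ t → pair (Dₗ (treeP t) a) F)
pair-Dₗ-linear x zero F = sym (pair-zero x)
pair-Dₗ-linear x (suc a) F = trans (pair-Ψ (suc a) (lieP x) F) (trans (pair-lieP x _) (pair-ext x (λ t → sym (pair-Ψ (suc a) (treeP t) F))))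

pair-D-linear : ∀ x w G → pair (D (lieP x) w) G ≡ pair x (λ t → pair (D (treeP t) w) G)
pair-D-linear x [] G = sym (pair-zero x)
pair-D-linear x (a ∷ w) G = trans (pair-D-∷ (lieP x) a w G)
  (trans (cong₂ _+_ (pair-Dₗ-linear x a (λ z → G (z ++ w))) (pair-D-linear x w (λ z → G (a ∷ z))))
   (trans (sym (pair-add x (λ t → pair (Dₗ (treeP t) a) (λ z → G (z ++ w))) (λ t → pair (D (treeP t) w) (λ z → G (a ∷ z)))))
     (pair-ext x (λ t → sym (pair-D-∷ (treeP t) a w G)))))

pair-map-snd : (h : ℚ × I → ℚ × I′) (g : I → I′) (L : List (ℚ × I)) (F : I′ → ℚ) →
  (∀ c t → h (c , t) ≡ (c , g t)) → pair (map h L) F ≡ pair L (λ t → F (g t))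
pair-map-snd h g [] F e = refl
pair-map-snd h g ((c , t) ∷ L) F e rewrite e c t = cong (c * F (g t) +_) (pair-map-snd h g L F e)

▷t-is-D : ∀ t u G → pair (t ▷t u) (λ t′ → pair (treeP t′) G) ≡ pair (treeP u) (λ w → pair (D (treeP t) w) G)
▷t-is-D t (leaf zero) G = sym (trans (pair-letterP 0 (λ w → pair (D (treeP t) w) G)) (pair-D-letter (treeP t) 0 G))
▷t-is-D t (leaf (suc s)) G = begin
    pair (t ▷t leaf (suc s)) (λ t′ → pair (treeP t′) G)
  ≡⟨ pair-map (λ l → (mult k l , leaf (suc s ℕ.+ sum k ∸ sum l) ⋆ relabel t l)) (box k) (λ t′ → pair (treeP t′) G) ⟩
    ∑ₘ k (λ l → pair (bracket (letterP (suc s ℕ.+ sum k ∸ sum l)) (treeP (relabel t l))) G)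
  ≡⟨ ∑ₘ-ext k (λ l ib → trans (cong (λ j → pair (bracket (letterP j) (treeP (relabel t l))) G) (NP.+-∸-assoc (suc s) (InBox-sum ib)))
        (pair-bracket-linearʳ (letterP (suc s ℕ.+ (sum k ∸ sum l))) (treeP (relabel t l)) G)) ⟩
    ∑ₘ k (λ l → pair (treeP (relabel t l)) (λ w → pair (bracketLetter (suc s) (sum k ∸ sum l , w)) G))
  ≡⟨ Θ-treeP t (λ α → pair (bracketLetter (suc s) α) G) ⟨
    pairΘ (treeP t) (λ α → pair (bracketLetter (suc s) α) G)
  ≡⟨ pair-Ψ (suc s) (treeP t) G ⟨
    pair (Ψ (suc s) (treeP t)) G
  ≡⟨ trans (pair-letterP (suc s) (λ w → pair (D (treeP t) w) G)) (pair-D-letter (treeP t) (suc s) G) ⟨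
    pair (treeP (leaf (suc s))) (λ w → pair (D (treeP t) w) G) ∎
  where
  open ≡-Reasoning
  k = leaves t
▷t-is-D t (u ⋆ w) G = begin
    pair (t ▷t (u ⋆ w)) (λ t′ → pair (treeP t′) G)
  ≡⟨ pair-++ (map (λ { (c , u′) → (c , u′ ⋆ w) }) (t ▷t u)) (map (λ { (c , w′) → (c , u ⋆ w′) }) (t ▷t w)) (λ t′ → pair (treeP t′) G) ⟩
    pair (map (λ { (c , u′) → (c , u′ ⋆ w) }) (t ▷t u)) (λ t′ → pair (treeP t′) G)
      + pair (map (λ { (c , w′) → (c , u ⋆ w′) }) (t ▷t w)) (λ t′ → pair (treeP t′) G)
  ≡⟨ cong₂ _+_ (pair-map-snd (λ { (c , u′) → (c , u′ ⋆ w) }) (_⋆ w) (t ▷t u) (λ t′ → pair (treeP t′) G) (λ c t → refl))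
               (pair-map-snd (λ { (c , w′) → (c , u ⋆ w′) }) (u ⋆_) (t ▷t w) (λ t′ → pair (treeP t′) G) (λ c t → refl)) ⟩
    pair (t ▷t u) (λ u′ → pair (bracket (treeP u′) (treeP w)) G) + pair (t ▷t w) (λ w′ → pair (bracket (treeP u) (treeP w′)) G)
  ≡⟨ cong₂ _+_ (trans (pair-ext (t ▷t u) (λ u′ → pair-bracket-linearˡ (treeP u′) (treeP w) G))
                      (▷t-is-D t u (λ p → pair (bracket (wordP p) (treeP w)) G)))
               (trans (pair-ext (t ▷t w) (λ w′ → pair-bracket-linearʳ (treeP u) (treeP w′) G))
                      (▷t-is-D t w (λ q → pair (bracket (treeP u) (wordP q)) G))) ⟩
    pair (treeP u) (λ a → pair (D (treeP t) a) (λ p → pair (bracket (wordP p) (treeP w)) G))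
      + pair (treeP w) (λ b → pair (D (treeP t) b) (λ q → pair (bracket (treeP u) (wordP q)) G))
  ≡⟨ pair-D-bracket (treeP t) (treeP u) (treeP w) G ⟩
    pair (treeP (u ⋆ w)) (λ z → pair (D (treeP t) z) G) ∎
  where open ≡-Reasoning

▷L-is-D : ∀ x z G → pair (lieP (x ▷L z)) G ≡ pair (lieP z) (λ w → pair (D (lieP x) w) G)
▷L-is-D x z G = begin
    pair (lieP (x ▷L z)) G
  ≡⟨ pair-lieP (x ▷L z) G ⟩
    pair (x ▷L z) (λ t → pair (treeP t) G)
  ≡⟨ pair-▷L x z (λ t → pair (treeP t) G) ⟩
    pair x (λ t → pair z (λ u → pair (t ▷t u) (λ t′ → pair (treeP t′) G)))
  ≡⟨ pair-ext x (λ t → pair-ext z (λ u → ▷t-is-D t u G)) ⟩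
    pair x (λ t → pair z (λ u → pair (treeP u) (λ w → pair (D (treeP t) w) G)))
  ≡⟨ pair-swap x z (λ t u → pair (treeP u) (λ w → pair (D (treeP t) w) G)) ⟩
    pair z (λ u → pair x (λ t → pair (treeP u) (λ w → pair (D (treeP t) w) G)))
  ≡⟨ pair-ext z (λ u → trans (pair-swap x (treeP u) (λ t w → pair (D (treeP t) w) G)) (pair-ext (treeP u) (λ w → sym (pair-D-linear x w G)))) ⟩
    pair z (λ u → pair (treeP u) (λ w → pair (D (lieP x) w) G))
  ≡⟨ pair-lieP z (λ w → pair (D (lieP x) w) G) ⟨
    pair (lieP z) (λ w → pair (D (lieP x) w) G) ∎
  where open ≡-Reasoning

-- D X commutes with right-nested bracketing, up to the term where D X hits the letters of q; since
-- those D X v_y are Lie elements (IsLie-Dₗ), that term is again a right-nested bracketing.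
pair-rnest-D : ∀ x q V G → pair (rnest q V) (λ z → pair (D (lieP x) z) G)
   ≡ pair V (λ u → pair (D (lieP x) u) (λ z → pair (rnest q (wordP z)) G)) + pair (D (lieP x) q) (λ w → pair (rnest w V) G)
pair-rnest-D x [] V G = sym (trans (+-identityʳ (pair V (λ u → pair (D (lieP x) u) (λ z → pair (wordP z) G))))
   (pair-ext V (λ u → pair-ext (D (lieP x) u) (λ z → pair-wordP z G))))
pair-rnest-D x (y ∷ q) V G = begin
    pair (rnest q (bracket V (letterP y))) (λ z → pair (D X z) G)
  ≡⟨ pair-rnest-D x q (bracket V (letterP y)) G ⟩
    pair (bracket V (letterP y)) (λ u → pair (D X u) K) + E
  ≡⟨ cong (_+ E) (pair-D-bracket X V (letterP y) K) ⟨
    (pair V (λ u → pair (D X u) (λ z → pair (bracket (wordP z) (letterP y)) K))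
      + pair (letterP y) (λ b → pair (D X b) (λ z → pair (bracket V (wordP z)) K))) + E
  ≡⟨ cong₂ (λ u v → (u + v) + E) (pair-ext V (λ u → pair-ext (D X u) (λ z → sym (pair-rnest-linear q (bracket (wordP z) (letterP y)) G))))
                                  hitLetter ⟩
    (pair V (λ u → pair (D X u) (λ z → pair (rnest (y ∷ q) (wordP z)) G)) + pair (Dₗ X y) (λ z → pair (rnest (z ++ q) V) G)) + E
  ≡⟨ +-assoc (pair V (λ u → pair (D X u) (λ z → pair (rnest (y ∷ q) (wordP z)) G))) (pair (Dₗ X y) (λ z → pair (rnest (z ++ q) V) G)) E ⟩
    pair V (λ u → pair (D X u) (λ z → pair (rnest (y ∷ q) (wordP z)) G)) + (pair (Dₗ X y) (λ z → pair (rnest (z ++ q) V) G) + E)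
  ≡⟨ cong (pair V (λ u → pair (D X u) (λ z → pair (rnest (y ∷ q) (wordP z)) G)) +_) (pair-D-∷ X y q (λ w → pair (rnest w V) G)) ⟨
    pair V (λ u → pair (D X u) (λ z → pair (rnest (y ∷ q) (wordP z)) G)) + pair (D X (y ∷ q)) (λ w → pair (rnest w V) G) ∎
  where
  open ≡-Reasoning
  X = lieP x
  K : Word → ℚ
  K z = pair (rnest q (wordP z)) G
  E = pair (D X q) (λ w → pair (rnest w (bracket V (letterP y))) G)
  hitLetter : pair (letterP y) (λ b → pair (D X b) (λ z → pair (bracket V (wordP z)) K)) ≡ pair (Dₗ X y) (λ z → pair (rnest (z ++ q) V) G)
  hitLetter = begin
      pair (letterP y) (λ b → pair (D X b) (λ z → pair (bracket V (wordP z)) K))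
    ≡⟨ trans (pair-letterP y (λ b → pair (D X b) (λ z → pair (bracket V (wordP z)) K))) (pair-D-letter X y (λ z → pair (bracket V (wordP z)) K)) ⟩
      pair (Dₗ X y) (λ z → pair (bracket V (wordP z)) K)
    ≡⟨ pair-bracket-linearʳ V (Dₗ X y) K ⟨
      pair (bracket V (Dₗ X y)) K
    ≡⟨ IsLie-Dₗ x y V K ⟨
      pair (Dₗ X y) (λ w → pair (rnest w V) K)
    ≡⟨ pair-ext (Dₗ X y) (λ w → trans (sym (pair-rnest-linear q (rnest w V) G)) (cong (λ P → pair P G) (sym (rnest-++ w q V)))) ⟩
      pair (Dₗ X y) (λ z → pair (rnest (z ++ q) V) G) ∎

pair-Θ-letter : ∀ J (Y : Tagged → ℚ) → pair (Θ (J ∷ [])) Y ≡ 𝕄 J (λ j → Y (J ∸ j , j ∷ []))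
pair-Θ-letter J Y = trans (pair-Θ (J ∷ []) Y) (trans (∑-box-∷ J [] (λ l → mult (J ∷ []) l * Y (sum (J ∷ []) ∸ sum l , l)))
  (∑<-ext (suc J) (λ j → trans (+-identityʳ (mult (J ∷ []) (j ∷ []) * Y (sum (J ∷ []) ∸ sum (j ∷ []) , j ∷ [])))
     (cong₂ (λ m n → m * Y (n , j ∷ [])) (trans (mult-∷ J [] j []) (*-identityʳ (m₁ J j)))
        (cong₂ _∸_ (NP.+-identityʳ J) (NP.+-identityʳ j))))))

∑<-pair : ∀ n (P : List (ℚ × I)) (F : ℕ → I → ℚ) → ∑< n (λ i → pair P (λ k → F i k)) ≡ pair P (λ k → ∑< n (λ i → F i k))
∑<-pair zero P F = sym (pair-zero P)
∑<-pair (suc n) P F = trans (cong (pair P (F 0) +_) (∑<-pair n P (λ i → F (suc i))))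
  (sym (pair-add P (F 0) (λ k → ∑< n (λ i → F (suc i) k))))

𝕄-pair : ∀ b (P : List (ℚ × I)) (F : ℕ → I → ℚ) → 𝕄 b (λ p → pair P (λ k → F p k)) ≡ pair P (λ k → 𝕄 b (λ p → F p k))
𝕄-pair b P F = trans (∑<-ext (suc b) (λ p → sym (pair-scal P (m₁ b p) (F p)))) (∑<-pair (suc b) P (λ p k → m₁ b p * F p k))

pairΘ-bracket-letter-word : ∀ J l (H : Tagged → ℚ) →
  pairΘ (bracket (letterP J) (wordP l)) H
  ≡ 𝕄 J (λ j → ∑ₘ l (λ q → H ((J ∸ j) ℕ.+ (sum l ∸ sum q) , j ∷ q) + - H ((J ∸ j) ℕ.+ (sum l ∸ sum q) , q ++ (j ∷ []))))
pairΘ-bracket-letter-word J l H = begin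
    pairΘ (bracket (letterP J) (wordP l)) H
  ≡⟨ trans (pair-bracket-wordʳ (letterP J) l (λ z → pair (Θ z) H))
           (cong₂ (λ x y → x + - y) (pair-letterP J (λ p → pair (Θ (p ++ l)) H)) (pair-letterP J (λ p → pair (Θ (l ++ p)) H))) ⟩
    pair (Θ ((J ∷ []) ++ l)) H + - pair (Θ (l ++ (J ∷ []))) H
  ≡⟨ cong₂ (λ x y → x + - y) (Θ-++ (J ∷ []) l H) (trans (Θ-++ l (J ∷ []) H) (pair-swap (Θ l) (Θ (J ∷ [])) (λ β α → H (β ⊙ α)))) ⟩
    pair (Θ (J ∷ [])) (λ α → pair (Θ l) (λ β → H (α ⊙ β))) + - pair (Θ (J ∷ [])) (λ α → pair (Θ l) (λ β → H (β ⊙ α)))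
  ≡⟨ trans (pair-ext (Θ (J ∷ [])) (λ α → pair-sub (Θ l) (λ β → H (α ⊙ β)) (λ β → H (β ⊙ α))))
           (pair-sub (Θ (J ∷ [])) (λ α → pair (Θ l) (λ β → H (α ⊙ β))) (λ α → pair (Θ l) (λ β → H (β ⊙ α)))) ⟨
    pair (Θ (J ∷ [])) (λ α → pair (Θ l) (λ β → H (α ⊙ β) + - H (β ⊙ α)))
  ≡⟨ pair-Θ-letter J (λ α → pair (Θ l) (λ β → H (α ⊙ β) + - H (β ⊙ α))) ⟩
    𝕄 J (λ j → pair (Θ l) (λ β → H ((J ∸ j , j ∷ []) ⊙ β) + - H (β ⊙ (J ∸ j , j ∷ []))))
  ≡⟨ 𝕄-ext J (λ j → trans (pair-Θ l (λ β → H ((J ∸ j , j ∷ []) ⊙ β) + - H (β ⊙ (J ∸ j , j ∷ []))))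
       (∑ₘ-ext l (λ q _ → cong (λ n → H ((J ∸ j) ℕ.+ (sum l ∸ sum q) , j ∷ q) + - H (n , q ++ (j ∷ [])))
                                 (NP.+-comm (sum l ∸ sum q) (J ∸ j))))) ⟩
    𝕄 J (λ j → ∑ₘ l (λ q → H ((J ∸ j) ℕ.+ (sum l ∸ sum q) , j ∷ q) + - H ((J ∸ j) ℕ.+ (sum l ∸ sum q) , q ++ (j ∷ [])))) ∎
  where open ≡-Reasoning

-- Θ (v_k ▷ v_{a+1}): the composition of multiplicities that appears is collapsed by mult-chain-collapse.
Θ-bracketLetter : ∀ a k (H : Tagged → ℚ) →
  pair (Θ k) (λ α → pairΘ (bracketLetter (suc a) α) H)
  ≡ 𝕄 (suc a) (λ p → pair (Θ k) (λ α → pair (bracketLetter p α) (λ z → H (suc a ∸ p , z))))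
Θ-bracketLetter a k H = begin
    pair (Θ k) (λ α → pairΘ (bracketLetter (suc a) α) H)
  ≡⟨ pair-Θ k (λ α → pairΘ (bracketLetter (suc a) α) H) ⟩
    ∑ₘ k (λ l → pairΘ (bracket (letterP (suc a ℕ.+ (sum k ∸ sum l))) (wordP l)) H)
  ≡⟨ ∑ₘ-ext k (λ l ib → trans (pairΘ-bracket-letter-word (suc a ℕ.+ (sum k ∸ sum l)) l H)
       (𝕄-ext< (suc a ℕ.+ (sum k ∸ sum l)) (λ j j≤ → ∑ₘ-ext l (λ q ibq →
          cong (λ n → H (n , j ∷ q) + - H (n , q ++ (j ∷ [])))
               ([[m+[n∸o]]∸p]+[o∸q]≡[m+n]∸[p+q] (NP.≤-pred j≤) (InBox-sum ibq) (InBox-sum ib)))))) ⟩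
    ∑ₘ k (λ l → 𝕄 (suc a ℕ.+ (sum k ∸ sum l)) (λ j → ∑ₘ l (E j)))
  ≡⟨ mult-chain-collapse k a E ⟩
    𝕄 (suc a) (λ p → ∑ₘ k (λ q → E (p ℕ.+ (sum k ∸ sum q)) q))
  ≡⟨ 𝕄-ext (suc a) (λ p → trans (∑ₘ-ext k (λ q ib → cong (λ n → H (n , (p ℕ.+ (sum k ∸ sum q)) ∷ q) + - H (n , q ++ ((p ℕ.+ (sum k ∸ sum q)) ∷ [])))
                                                        ([m+n]∸[[o+[n∸p]]+p]≡m∸o (suc a) p (InBox-sum ib))))
                                 (sym (trans (pair-Θ k (λ α → pair (bracketLetter p α) (λ z → H (suc a ∸ p , z))))
                                             (∑ₘ-ext k (λ q _ → pair-bracketLetter p (sum k ∸ sum q , q) (λ z → H (suc a ∸ p , z))))))) ⟩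
    𝕄 (suc a) (λ p → pair (Θ k) (λ α → pair (bracketLetter p α) (λ z → H (suc a ∸ p , z)))) ∎
  where
  open ≡-Reasoning
  E : ℕ → Word → ℚ
  E j q = H ((suc a ℕ.+ sum k) ∸ (j ℕ.+ sum q) , j ∷ q) + - H ((suc a ℕ.+ sum k) ∸ (j ℕ.+ sum q) , q ++ (j ∷ []))

Θ-Dₗ : ∀ X a (H : Tagged → ℚ) → pairΘ (Dₗ X a) H ≡ pair (Θ (a ∷ [])) (λ α → pair (D X (proj₂ α)) (λ w → H (proj₁ α , w)))
Θ-Dₗ X zero H = sym (trans (pair-Θ-letter 0 (λ α → pair (D X (proj₂ α)) (λ w → H (proj₁ α , w))))
  (trans (cong (λ z → m₁ 0 0 * z + 0ℚ) (pair-D-letter X 0 (λ w → H (0 , w)))) (solve 1 (λ m → m :* con 0ℚ :+ con 0ℚ := con 0ℚ) refl (m₁ 0 0))))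
Θ-Dₗ X (suc a) H = begin
    pairΘ (Ψ (suc a) X) H
  ≡⟨ pair-Ψ (suc a) X (λ z → pair (Θ z) H) ⟩
    pair X (λ k → pair (Θ k) (λ α → pairΘ (bracketLetter (suc a) α) H))
  ≡⟨ pair-ext X (λ k → Θ-bracketLetter a k H) ⟩
    pair X (λ k → 𝕄 (suc a) (λ p → Q p k))
  ≡⟨ 𝕄-pair (suc a) X Q ⟨
    𝕄 (suc a) (λ p → pair X (Q p))
  ≡⟨ ∑<-ext (suc (suc a)) Q≡Dₗ ⟩
    𝕄 (suc a) (λ j → pair (Dₗ X j) (λ w → H (suc a ∸ j , w)))
  ≡⟨ trans (pair-Θ-letter (suc a) (λ α → pair (D X (proj₂ α)) (λ w → H (proj₁ α , w))))
           (𝕄-ext (suc a) (λ j → pair-D-letter X j (λ w → H (suc a ∸ j , w)))) ⟨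
    pair (Θ (suc a ∷ [])) (λ α → pair (D X (proj₂ α)) (λ w → H (proj₁ α , w))) ∎
  where
  open ≡-Reasoning
  Q : ℕ → Word → ℚ
  Q p k = pair (Θ k) (λ α → pair (bracketLetter p α) (λ z → H (suc a ∸ p , z)))
  -- p = 0 is where Ψ 0 X ≠ Dₗ X 0 = 0, but it carries the weight m₁ (a+1) 0 = 0.
  Q≡Dₗ : ∀ p → m₁ (suc a) p * pair X (Q p) ≡ m₁ (suc a) p * pair (Dₗ X p) (λ w → H (suc a ∸ p , w))
  Q≡Dₗ zero    = trans (m₁-suc-zero-* a (pair X (Q 0))) (sym (m₁-suc-zero-* a (pair (Dₗ X 0) (λ w → H (suc a , w)))))
  Q≡Dₗ (suc p) = cong (m₁ (suc a) (suc p) *_) (sym (pair-Ψ (suc p) X (λ w → H (suc a ∸ suc p , w))))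

Θ-D : ∀ X k (H : Tagged → ℚ) → pairΘ (D X k) H ≡ pair (Θ k) (λ β → pair (D X (proj₂ β)) (λ w → H (proj₁ β , w)))
Θ-D X [] H = refl
Θ-D X (x ∷ k) H = begin
    pairΘ (D X (x ∷ k)) H
  ≡⟨ pair-D-∷ X x k (λ z → pair (Θ z) H) ⟩
    pair (Dₗ X x) (λ z → pair (Θ (z ++ k)) H) + pair (D X k) (λ z → pair (Θ ((x ∷ []) ++ z)) H)
  ≡⟨ cong₂ _+_ head tail ⟩
    pair (Θ (x ∷ [])) (λ α → pair (Θ k) (λ β → pair (D X (proj₂ α)) (λ w → H ((proj₁ α , w) ⊙ β))))
      + pair (Θ (x ∷ [])) (λ α → pair (Θ k) (λ β → pair (D X (proj₂ β)) (λ w → H (α ⊙ (proj₁ β , w)))))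
  ≡⟨ trans (pair-ext (Θ (x ∷ [])) (λ α → trans (pair-ext (Θ k) (λ β → pair-D-++ X (proj₂ α) (proj₂ β) (λ w → H (proj₁ α ℕ.+ proj₁ β , w))))
          (pair-add (Θ k) (λ β → pair (D X (proj₂ α)) (λ w → H ((proj₁ α , w) ⊙ β))) (λ β → pair (D X (proj₂ β)) (λ w → H (α ⊙ (proj₁ β , w)))))))
        (pair-add (Θ (x ∷ [])) (λ α → pair (Θ k) (λ β → pair (D X (proj₂ α)) (λ w → H ((proj₁ α , w) ⊙ β))))
                                (λ α → pair (Θ k) (λ β → pair (D X (proj₂ β)) (λ w → H (α ⊙ (proj₁ β , w)))))) ⟨
    pair (Θ (x ∷ [])) (λ α → pair (Θ k) (λ β → pair (D X (proj₂ (α ⊙ β))) (λ w → H (proj₁ (α ⊙ β) , w))))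
  ≡⟨ Θ-++ (x ∷ []) k (λ γ → pair (D X (proj₂ γ)) (λ w → H (proj₁ γ , w))) ⟨
    pair (Θ (x ∷ k)) (λ β → pair (D X (proj₂ β)) (λ w → H (proj₁ β , w))) ∎
  where
  open ≡-Reasoning
  head : pair (Dₗ X x) (λ z → pair (Θ (z ++ k)) H) ≡ pair (Θ (x ∷ [])) (λ α → pair (Θ k) (λ β → pair (D X (proj₂ α)) (λ w → H ((proj₁ α , w) ⊙ β))))
  head = begin
      pair (Dₗ X x) (λ z → pair (Θ (z ++ k)) H)
    ≡⟨ pair-ext (Dₗ X x) (λ z → trans (Θ-++ z k H) (pair-swap (Θ z) (Θ k) (λ α β → H (α ⊙ β)))) ⟩
      pair (Dₗ X x) (λ z → pair (Θ k) (λ β → pair (Θ z) (λ α → H (α ⊙ β))))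
    ≡⟨ pair-swap (Dₗ X x) (Θ k) (λ z β → pair (Θ z) (λ α → H (α ⊙ β))) ⟩
      pair (Θ k) (λ β → pairΘ (Dₗ X x) (λ α → H (α ⊙ β)))
    ≡⟨ pair-ext (Θ k) (λ β → Θ-Dₗ X x (λ α → H (α ⊙ β))) ⟩
      pair (Θ k) (λ β → pair (Θ (x ∷ [])) (λ α → pair (D X (proj₂ α)) (λ w → H ((proj₁ α , w) ⊙ β))))
    ≡⟨ pair-swap (Θ k) (Θ (x ∷ [])) (λ β α → pair (D X (proj₂ α)) (λ w → H ((proj₁ α , w) ⊙ β))) ⟩
      pair (Θ (x ∷ [])) (λ α → pair (Θ k) (λ β → pair (D X (proj₂ α)) (λ w → H ((proj₁ α , w) ⊙ β)))) ∎
  tail : pair (D X k) (λ z → pair (Θ ((x ∷ []) ++ z)) H) ≡ pair (Θ (x ∷ [])) (λ α → pair (Θ k) (λ β → pair (D X (proj₂ β)) (λ w → H (α ⊙ (proj₁ β , w)))))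
  tail = begin
      pair (D X k) (λ z → pair (Θ ((x ∷ []) ++ z)) H)
    ≡⟨ pair-ext (D X k) (λ z → Θ-++ (x ∷ []) z H) ⟩
      pair (D X k) (λ z → pair (Θ (x ∷ [])) (λ α → pair (Θ z) (λ β → H (α ⊙ β))))
    ≡⟨ pair-swap (D X k) (Θ (x ∷ [])) (λ z α → pair (Θ z) (λ β → H (α ⊙ β))) ⟩
      pair (Θ (x ∷ [])) (λ α → pairΘ (D X k) (λ β → H (α ⊙ β)))
    ≡⟨ pair-ext (Θ (x ∷ [])) (λ α → Θ-D X k (λ β → H (α ⊙ β))) ⟩
      pair (Θ (x ∷ [])) (λ α → pair (Θ k) (λ β → pair (D X (proj₂ β)) (λ w → H (α ⊙ (proj₁ β , w))))) ∎

-- A(k) ▷ v_s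

rnestAt : ℕ → Tagged → Poly
rnestAt s α = rnest (proj₂ α) (letterP (s ℕ.+ proj₁ α))

-- Φ s k = Σ_l m_{k,l} R_l(v_{s+|k|-|l|}) with R_l = rnest l: the claimed value of A(k) ▷ v_s.
Φ : ℕ → Word → Poly
Φ s k = linExt (rnestAt s) (Θ k)

pair-Φ : ∀ s k G → pair (Φ s k) G ≡ pair (Θ k) (λ α → pair (rnestAt s α) G)
pair-Φ s k G = pair-linExt (rnestAt s) (Θ k) G

pair-lie-Φ-++ : ∀ x s b G →
  pair (lieP x) (λ a → pair (Φ (suc s) (a ++ b)) G)
  ≡ pair (Θ b) (λ β → pair (Dₗ (lieP x) (suc s ℕ.+ proj₁ β)) (λ u → pair (rnest (proj₂ β) (wordP u)) G))
pair-lie-Φ-++ x s b G = begin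
    pair X (λ a → pair (Φ (suc s) (a ++ b)) G)
  ≡⟨ pair-ext X (λ a → trans (pair-Φ (suc s) (a ++ b) G) (trans (Θ-++ a b (λ γ → pair (rnestAt (suc s) γ) G))
       (trans (pair-ext (Θ a) (λ α → pair-ext (Θ b) (λ β →
            trans (cong (λ P → pair P G) (rnest-++ (proj₂ α) (proj₂ β) (letterP (suc s ℕ.+ (proj₁ α ℕ.+ proj₁ β)))))
                  (pair-rnest-linear (proj₂ β) (rnest (proj₂ α) (letterP (suc s ℕ.+ (proj₁ α ℕ.+ proj₁ β)))) G))))
         (pair-swap (Θ a) (Θ b) (λ α β → pair (rnest (proj₂ α) (letterP (suc s ℕ.+ (proj₁ α ℕ.+ proj₁ β)))) (K β)))))) ⟩
    pair X (λ a → pair (Θ b) (λ β → pair (Θ a) (λ α → pair (rnest (proj₂ α) (letterP (suc s ℕ.+ (proj₁ α ℕ.+ proj₁ β)))) (K β))))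
  ≡⟨ pair-swap X (Θ b) (λ a β → pair (Θ a) (λ α → pair (rnest (proj₂ α) (letterP (suc s ℕ.+ (proj₁ α ℕ.+ proj₁ β)))) (K β))) ⟩
    pair (Θ b) (λ β → pairΘ X (λ α → pair (rnest (proj₂ α) (letterP (suc s ℕ.+ (proj₁ α ℕ.+ proj₁ β)))) (K β)))
  ≡⟨ pair-ext (Θ b) (λ β → trans (IsLieΘ-lieP x (λ n → letterP (suc s ℕ.+ (n ℕ.+ proj₁ β))) (λ _ → K β))
       (trans (pairΘ-ext X (λ α → cong (λ j → pair (bracket (letterP j) (wordP (proj₂ α))) (K β)) (shift (proj₁ α) (proj₁ β))))
         (sym (pair-Ψ (suc s ℕ.+ proj₁ β) X (K β))))) ⟩
    pair (Θ b) (λ β → pair (Ψ (suc s ℕ.+ proj₁ β) X) (K β)) ∎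
  where
  open ≡-Reasoning
  X = lieP x
  K : Tagged → Word → ℚ
  K β u = pair (rnest (proj₂ β) (wordP u)) G
  shift : ∀ n m → suc s ℕ.+ (n ℕ.+ m) ≡ (suc s ℕ.+ m) ℕ.+ n
  shift n m = trans (cong (suc s ℕ.+_) (NP.+-comm n m)) (sym (NP.+-assoc (suc s) m n))

pair-D-Φ : ∀ x s k G →
  pair (Φ s k) (λ z → pair (D (lieP x) z) G)
  ≡ pair (Θ k) (λ β → pair (Dₗ (lieP x) (s ℕ.+ proj₁ β)) (λ u → pair (rnest (proj₂ β) (wordP u)) G))
    + pair (Θ k) (λ β → pair (D (lieP x) (proj₂ β)) (λ w → pair (rnestAt s (proj₁ β , w)) G))
pair-D-Φ x s k G = begin
    pair (Φ s k) (λ z → pair (D X z) G)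
  ≡⟨ pair-Φ s k (λ z → pair (D X z) G) ⟩
    pair (Θ k) (λ β → pair (rnestAt s β) (λ z → pair (D X z) G))
  ≡⟨ pair-ext (Θ k) (λ β → trans (pair-rnest-D x (proj₂ β) (letterP (s ℕ.+ proj₁ β)) G)
       (cong (_+ pair (D X (proj₂ β)) (λ w → pair (rnest w (letterP (s ℕ.+ proj₁ β))) G))
         (trans (pair-letterP (s ℕ.+ proj₁ β) (λ u → pair (D X u) (K β))) (pair-D-letter X (s ℕ.+ proj₁ β) (K β))))) ⟩
    pair (Θ k) (λ β → pair (Dₗ X (s ℕ.+ proj₁ β)) (K β) + pair (D X (proj₂ β)) (λ w → pair (rnestAt s (proj₁ β , w)) G))
  ≡⟨ pair-add (Θ k) (λ β → pair (Dₗ X (s ℕ.+ proj₁ β)) (K β)) (λ β → pair (D X (proj₂ β)) (λ w → pair (rnestAt s (proj₁ β , w)) G)) ⟩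
    pair (Θ k) (λ β → pair (Dₗ X (s ℕ.+ proj₁ β)) (K β)) + pair (Θ k) (λ β → pair (D X (proj₂ β)) (λ w → pair (rnestAt s (proj₁ β , w)) G)) ∎
  where
  open ≡-Reasoning
  X = lieP x
  K : Tagged → Word → ℚ
  K β u = pair (rnest (proj₂ β) (wordP u)) G

pair-Φ-D : ∀ X s k G → pair (D X k) (λ z → pair (Φ s z) G) ≡ pair (Θ k) (λ β → pair (D X (proj₂ β)) (λ w → pair (rnestAt s (proj₁ β , w)) G))
pair-Φ-D X s k G = trans (pair-ext (D X k) (λ z → pair-Φ s z G)) (Θ-D X k (λ γ → pair (rnestAt s γ) G))

-- The recursion (x A) ▷ y = x ▷ (A ▷ y) − (x ▷ A) ▷ y, checked on the candidate Φ: Φ (x b) = D x (Φ b) − Φ (D x b).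
Φ-recursion : ∀ x s b G →
  pair (lieP x) (λ a → pair (Φ (suc s) (a ++ b)) G)
  ≡ pair (Φ (suc s) b) (λ z → pair (D (lieP x) z) G) + - pair (D (lieP x) b) (λ z → pair (Φ (suc s) z) G)
Φ-recursion x s b G = begin
    pair (lieP x) (λ a → pair (Φ (suc s) (a ++ b)) G)   ≡⟨ pair-lie-Φ-++ x s b G ⟩
    Y                                                   ≡⟨ solve 2 (λ y z → y := (y :+ z) :+ :- z) refl Y Z ⟩
    (Y + Z) + - Z                                       ≡⟨ cong₂ (λ u v → u + - v) (pair-D-Φ x (suc s) b G) (pair-Φ-D (lieP x) (suc s) b G) ⟨
    pair (Φ (suc s) b) (λ z → pair (D (lieP x) z) G) + - pair (D (lieP x) b) (λ z → pair (Φ (suc s) z) G) ∎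
  where
  open ≡-Reasoning
  Y = pair (Θ b) (λ β → pair (Dₗ (lieP x) (suc s ℕ.+ proj₁ β)) (λ u → pair (rnest (proj₂ β) (wordP u)) G))
  Z = pair (Θ b) (λ β → pair (D (lieP x) (proj₂ β)) (λ w → pair (rnestAt (suc s) (proj₁ β , w)) G))

product : ∀ {n} → Vec LieC n → Poly
product [] = wordP []
product (x ∷ A) = lieP x *ₚ product A

∑-tabulate : ∀ {X : Set} n (f : Fin n → X) (g : X → ℚ) → ∑ (tabulate f) g ≡ ∑ (allFin n) (λ i → g (f i))
∑-tabulate zero f g = refl
∑-tabulate (suc n) f g = cong (g (f zero) +_) (trans (∑-tabulate n (λ i → f (suc i)) g) (sym (∑-tabulate n suc (λ i → g (f i)))))

pair-D-*ₚ : ∀ X P Q F → pair (P *ₚ Q) (λ w → pair (D X w) F)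
  ≡ pair P (λ a → pair (D X a) (λ z → pair Q (λ b → F (z ++ b)))) + pair P (λ a → pair Q (λ w → pair (D X w) (λ b → F (a ++ b))))
pair-D-*ₚ X P Q F = begin
    pair (P *ₚ Q) (λ w → pair (D X w) F)
  ≡⟨ pair-*ₚ P Q (λ w → pair (D X w) F) ⟩
    pair P (λ a → pair Q (λ b → pair (D X (a ++ b)) F))
  ≡⟨ pair₂-D-++ X P Q F ⟩
    pair P (λ a → pair Q (λ b → pair (D X a) (λ z → F (z ++ b)))) + pair P (λ a → pair Q (λ b → pair (D X b) (λ z → F (a ++ z))))
  ≡⟨ cong (_+ pair P (λ a → pair Q (λ b → pair (D X b) (λ z → F (a ++ z))))) (pair-ext P (λ a → pair-swap Q (D X a) (λ b z → F (z ++ b)))) ⟩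
    pair P (λ a → pair (D X a) (λ z → pair Q (λ b → F (z ++ b)))) + pair P (λ a → pair Q (λ w → pair (D X w) (λ b → F (a ++ b)))) ∎
  where open ≡-Reasoning

∑-update-product : ∀ x n (A : Vec LieC n) F →
  ∑ (allFin n) (λ i → pair (product (A [ i ]%= (x ▷L_))) F) ≡ pair (product A) (λ w → pair (D (lieP x) w) F)
∑-update-product x zero [] F = refl
∑-update-product x (suc n) (y ∷ A) F = begin
    ∑ (allFin (suc n)) (λ i → pair (product ((y ∷ A) [ i ]%= (x ▷L_))) F)
  ≡⟨ cong (pair (product ((x ▷L y) ∷ A)) F +_) (∑-tabulate n suc (λ i → pair (product ((y ∷ A) [ i ]%= (x ▷L_))) F)) ⟩
    pair (lieP (x ▷L y) *ₚ product A) F + ∑ (allFin n) (λ i → pair (lieP y *ₚ product (A [ i ]%= (x ▷L_))) F)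
  ≡⟨ cong₂ _+_ (trans (pair-*ₚ (lieP (x ▷L y)) (product A) F) (▷L-is-D x y (λ a → pair (product A) (λ b → F (a ++ b)))))
       (trans (∑-ext (allFin n) (λ i → pair-*ₚ (lieP y) (product (A [ i ]%= (x ▷L_))) F))
         (trans (sym (pair-∑ (lieP y) (allFin n) (λ a i → pair (product (A [ i ]%= (x ▷L_))) (λ b → F (a ++ b)))))
           (pair-ext (lieP y) (λ a → ∑-update-product x n A (λ b → F (a ++ b)))))) ⟩
    pair (lieP y) (λ w → pair (D (lieP x) w) (λ a → pair (product A) (λ b → F (a ++ b))))
      + pair (lieP y) (λ a → pair (product A) (λ w → pair (D (lieP x) w) (λ b → F (a ++ b))))
  ≡⟨ pair-D-*ₚ (lieP x) (lieP y) (product A) F ⟨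
    pair (product (y ∷ A)) (λ w → pair (D (lieP x) w) F) ∎
  where open ≡-Reasoning

pair-sumL-map : ∀ {X : Set} (h : X → LieC) xs F → pair (sumL (map h xs)) F ≡ ∑ xs (λ i → pair (h i) F)
pair-sumL-map h [] F = refl
pair-sumL-map h (x ∷ xs) F = trans (pair-++ (h x) (sumL (map h xs)) F) (cong (pair (h x) F +_) (pair-sumL-map h xs F))

letterL : ℕ → LieC
letterL s = (1ℚ , leaf s) ∷ []

pair-letterL : ∀ s F → pair (lieP (letterL s)) F ≡ F (s ∷ [])
pair-letterL s F = trans (pair-lieP (letterL s) F)
  (trans (solve 1 (λ x → con 1ℚ :* x :+ con 0ℚ := x) refl (pair (letterP s) F)) (pair-letterP s F))

actU-Φ : ∀ n (A : Vec LieC n) s G → pair (lieP (actU n A (letterL (suc s)))) G ≡ pair (product A) (λ w → pair (Φ (suc s) w) G)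
actU-Φ zero [] s G = begin
    pair (lieP (letterL (suc s))) G                ≡⟨ pair-letterL (suc s) G ⟩
    G (suc s ∷ [])                                  ≡⟨ cong (λ j → G (j ∷ [])) (NP.+-identityʳ (suc s)) ⟨
    G ((suc s ℕ.+ 0) ∷ [])                          ≡⟨ pair-letterP (suc s ℕ.+ 0) G ⟨
    pair (letterP (suc s ℕ.+ 0)) G                  ≡⟨ solve 1 (λ x → x := con 1ℚ :* x :+ con 0ℚ) refl (pair (letterP (suc s ℕ.+ 0)) G) ⟩
    1ℚ * pair (letterP (suc s ℕ.+ 0)) G + 0ℚ        ≡⟨ trans (pair-wordP [] (λ w → pair (Φ (suc s) w) G)) (pair-Φ (suc s) [] G) ⟨
    pair (product []) (λ w → pair (Φ (suc s) w) G)  ∎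
  where open ≡-Reasoning
actU-Φ (suc n) (x ∷ A) s G = begin
    pair (lieP (P ++ scaleL (- 1ℚ) Q)) G
  ≡⟨ trans (pair-lieP (P ++ scaleL (- 1ℚ) Q) G) (pair-++ P (scaleL (- 1ℚ) Q) (λ t → pair (treeP t) G)) ⟩
    pair P (λ t → pair (treeP t) G) + pair (scaleL (- 1ℚ) Q) (λ t → pair (treeP t) G)
  ≡⟨ cong₂ _+_ (trans (sym (pair-lieP P G)) (trans (▷L-is-D x (actU n A (letterL (suc s))) G) (actU-Φ n A s (λ w → pair (D X w) G))))
               (trans (pair-scaleL (- 1ℚ) Q (λ t → pair (treeP t) G)) (cong (- 1ℚ *_) hitFactors)) ⟩
    pair (product A) T₁ + - 1ℚ * pair (product A) T₂
  ≡⟨ solve 2 (λ a b → a :+ con (- 1ℚ) :* b := a :+ :- b) refl (pair (product A) T₁) (pair (product A) T₂) ⟩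
    pair (product A) T₁ + - pair (product A) T₂
  ≡⟨ trans (pair-ext (product A) (λ b → Φ-recursion x s b G)) (pair-sub (product A) T₁ T₂) ⟨
    pair (product A) (λ b → pair X (λ a → pair (Φ (suc s) (a ++ b)) G))
  ≡⟨ trans (pair-*ₚ X (product A) (λ w → pair (Φ (suc s) w) G)) (pair-swap X (product A) (λ a b → pair (Φ (suc s) (a ++ b)) G)) ⟨
    pair (product (x ∷ A)) (λ w → pair (Φ (suc s) w) G) ∎
  where
  open ≡-Reasoning
  X = lieP x
  P = x ▷L actU n A (letterL (suc s))
  h : Fin n → LieC
  h i = actU n (A [ i ]%= (x ▷L_)) (letterL (suc s))
  Q = sumL (map h (allFin n))
  T₁ T₂ : Word → ℚ
  T₁ b = pair (Φ (suc s) b) (λ z → pair (D X z) G)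
  T₂ b = pair (D X b) (λ z → pair (Φ (suc s) z) G)
  hitFactors : pair Q (λ t → pair (treeP t) G) ≡ pair (product A) T₂
  hitFactors = trans (pair-sumL-map h (allFin n) (λ t → pair (treeP t) G))
    (trans (∑-ext (allFin n) (λ i → trans (sym (pair-lieP (h i) G)) (actU-Φ n (A [ i ]%= (x ▷L_)) s G)))
      (∑-update-product x n A (λ w → pair (Φ (suc s) w) G)))

pair-product-letters : ∀ k F → pair (product (lettersV k)) F ≡ F k
pair-product-letters [] F = pair-wordP [] F
pair-product-letters (c ∷ k) F = trans (pair-*ₚ (lieP (letterL c)) (product (lettersV k)) F)
  (trans (pair-letterL c (λ a → pair (product (lettersV k)) (λ b → F (a ++ b)))) (pair-product-letters k (λ b → F (c ∷ b))))

-- Expanding right-nested brackets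

sandwich : Word → Poly → Word → (Word → ℚ) → ℚ
sandwich a V b G = pair ((antipode (wordP a) *ₚ V) *ₚ wordP b) G

pair-sandwich : ∀ a V b G → sandwich a V b G ≡ sgn (length a) * pair V (λ v → G ((reverse a ++ v) ++ b))
pair-sandwich a V b G = begin
    pair ((antipode (wordP a) *ₚ V) *ₚ wordP b) G
  ≡⟨ pair-*ₚ (antipode (wordP a) *ₚ V) (wordP b) G ⟩
    pair (antipode (wordP a) *ₚ V) (λ u → pair (wordP b) (λ w → G (u ++ w)))
  ≡⟨ pair-ext (antipode (wordP a) *ₚ V) (λ u → pair-wordP b (λ w → G (u ++ w))) ⟩
    pair (antipode (wordP a) *ₚ V) (λ u → G (u ++ b))
  ≡⟨ pair-*ₚ (antipode (wordP a)) V (λ u → G (u ++ b)) ⟩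
    pair (antipode (wordP a)) (λ r → pair V (λ v → G ((r ++ v) ++ b)))
  ≡⟨ pair-antipode (wordP a) (λ r → pair V (λ v → G ((r ++ v) ++ b))) ⟩
    pair (wordP a) (λ w → sgn (length w) * pair V (λ v → G ((reverse w ++ v) ++ b)))
  ≡⟨ pair-wordP a (λ w → sgn (length w) * pair V (λ v → G ((reverse w ++ v) ++ b))) ⟩
    sgn (length a) * pair V (λ v → G ((reverse a ++ v) ++ b)) ∎
  where open ≡-Reasoning

sandwich-bracket : ∀ a V y b G → sandwich a (bracket V (letterP y)) b G ≡ sandwich (y ∷ a) V b G + sandwich a V (y ∷ b) G
sandwich-bracket a V y b G = begin
    sandwich a (bracket V (letterP y)) b G
  ≡⟨ pair-sandwich a (bracket V (letterP y)) b G ⟩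
    sgn (length a) * pair (bracket V (wordP (y ∷ []))) (λ v → G ((reverse a ++ v) ++ b))
  ≡⟨ cong (sgn (length a) *_) (pair-bracket-wordʳ V (y ∷ []) (λ v → G ((reverse a ++ v) ++ b))) ⟩
    sgn (length a) * (pair V (λ v → G ((reverse a ++ (v ++ (y ∷ []))) ++ b)) + - pair V (λ v → G ((reverse a ++ (y ∷ v)) ++ b)))
  ≡⟨ cong₂ (λ p q → sgn (length a) * (p + - q))
       (pair-ext V (λ v → cong G (trans (++-assoc (reverse a) (v ++ (y ∷ [])) b)
                                 (trans (cong (reverse a ++_) (++-assoc v (y ∷ []) b)) (sym (++-assoc (reverse a) v (y ∷ b)))))))
       (pair-ext V (λ v → cong G (cong (_++ b) (trans (sym (++-assoc (reverse a) (y ∷ []) v)) (cong (_++ v) (sym (unfold-reverse y a))))))) ⟩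
    sgn (length a) * (pair V (λ v → G ((reverse a ++ v) ++ (y ∷ b))) + - pair V (λ v → G ((reverse (y ∷ a) ++ v) ++ b)))
  ≡⟨ solve 3 (λ s p q → s :* (p :+ :- q) := (:- s) :* q :+ s :* p) refl
       (sgn (length a)) (pair V (λ v → G ((reverse a ++ v) ++ (y ∷ b)))) (pair V (λ v → G ((reverse (y ∷ a) ++ v) ++ b))) ⟩
    - sgn (length a) * pair V (λ v → G ((reverse (y ∷ a) ++ v) ++ b)) + sgn (length a) * pair V (λ v → G ((reverse a ++ v) ++ (y ∷ b)))
  ≡⟨ cong₂ _+_ (pair-sandwich (y ∷ a) V b G) (pair-sandwich a V (y ∷ b) G) ⟨
    sandwich (y ∷ a) V b G + sandwich a V (y ∷ b) G ∎
  where open ≡-Reasoning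

rnest-splits : ∀ l V G → pair (rnest l V) G ≡ ∑ (splits l) (λ ab → sandwich (proj₁ ab) V (proj₂ ab) G)
rnest-splits [] V G = sym (trans (+-identityʳ (sandwich [] V [] G)) (trans (pair-sandwich [] V [] G)
   (trans (*-identityˡ (pair V (λ v → G (v ++ [])))) (pair-ext V (λ v → cong G (++-identityʳ v))))))
rnest-splits (y ∷ l) V G = trans (rnest-splits l (bracket V (letterP y)) G)
  (trans (∑-ext (splits l) (λ { (a , b) → trans (sandwich-bracket a V y b G) (cong (sandwich (y ∷ a) V b G +_) (sym (+-identityʳ _))) }))
    (sym (∑-concatMap (λ { (a , b) → (y ∷ a , b) ∷ (a , y ∷ b) ∷ [] }) (splits l) (λ ab → sandwich (proj₁ ab) V (proj₂ ab) G))))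

pair-sumP-map : ∀ {X : Set} (h : X → Poly) xs G (F : X → ℚ) → (∀ x → pair (h x) G ≡ F x) → pair (sumP (map h xs)) G ≡ ∑ xs F
pair-sumP-map h [] G F e = refl
pair-sumP-map h (x ∷ xs) G F e = trans (pair-++ (h x) (sumP (map h xs)) G) (cong₂ _+_ (e x) (pair-sumP-map h xs G F e))

pair-sumP-scale : ∀ {X : Set} (xs : List X) (c : X → ℚ) (Q : X → Poly) G →
  pair (sumP (map (λ x → scaleP (c x) (Q x)) xs)) G ≡ ∑ xs (λ x → c x * pair (Q x) G)
pair-sumP-scale xs c Q G = pair-sumP-map (λ x → scaleP (c x) (Q x)) xs G (λ x → c x * pair (Q x) G) (λ x → pair-scaleP (c x) (Q x) G)

pair-rhs : ∀ k s G → pair (rhs k s) G ≡ ∑ₘ k (λ l → ∑ (splits l) (λ ab → sandwich (proj₁ ab) (letterP (s ℕ.+ sum k ∸ sum l)) (proj₂ ab) G))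
pair-rhs k s G = trans (pair-sumP-scale (box k) (mult k) _ G)
  (∑-ext (box k) (λ l → cong (mult k l *_) (pair-sumP-map _ (splits l) G _ (λ { (a , b) → refl }))))

actWord-suc : ∀ k s → actWord k (suc s) ∼ rhs k (suc s)
actWord-suc k s G = begin
    pair (actWord k (suc s)) G
  ≡⟨ actU-Φ (length k) (lettersV k) s G ⟩
    pair (product (lettersV k)) (λ w → pair (Φ (suc s) w) G)
  ≡⟨ pair-product-letters k (λ w → pair (Φ (suc s) w) G) ⟩
    pair (Φ (suc s) k) G
  ≡⟨ trans (pair-Φ (suc s) k G) (pair-Θ k (λ α → pair (rnestAt (suc s) α) G)) ⟩
    ∑ₘ k (λ l → pair (rnest l (letterP (suc s ℕ.+ (sum k ∸ sum l)))) G)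
  ≡⟨ ∑ₘ-ext k (λ l ib → trans (rnest-splits l (letterP (suc s ℕ.+ (sum k ∸ sum l))) G)
       (∑-ext (splits l) (λ { (a , b) → cong (λ j → sandwich a (letterP j) b G) (sym (NP.+-∸-assoc (suc s) (InBox-sum ib))) }))) ⟩
    ∑ₘ k (λ l → ∑ (splits l) (λ ab → sandwich (proj₁ ab) (letterP (suc s ℕ.+ sum k ∸ sum l)) (proj₂ ab) G))
  ≡⟨ pair-rhs k (suc s) G ⟨
    pair (rhs k (suc s)) G ∎
  where open ≡-Reasoning

▷L-letterL-zero : ∀ x → x ▷L letterL 0 ≡ []
▷L-letterL-zero [] = refl
▷L-letterL-zero ((c , t) ∷ x) = ▷L-letterL-zero x

▷L-[] : ∀ x → x ▷L [] ≡ []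
▷L-[] [] = refl
▷L-[] ((c , t) ∷ x) = ▷L-[] x

sumL-map-[] : ∀ {X : Set} (xs : List X) (h : X → LieC) → (∀ i → h i ≡ []) → sumL (map h xs) ≡ []
sumL-map-[] [] h e = refl
sumL-map-[] (x ∷ xs) h e = cong₂ _++_ (e x) (sumL-map-[] xs h e)

actU-letterL-zero : ∀ n (A : Vec LieC (suc n)) → actU (suc n) A (letterL 0) ≡ []
actU-letterL-zero zero (x ∷ []) = cong (_++ []) (▷L-letterL-zero x)
actU-letterL-zero (suc n) (x ∷ A) = cong₂ (λ P Q → P ++ scaleL (- 1ℚ) Q)
  (trans (cong (x ▷L_) (actU-letterL-zero n A)) (▷L-[] x))
  (sumL-map-[] (allFin (suc n)) (λ i → actU (suc n) (A [ i ]%= (x ▷L_)) (letterL 0)) (λ i → actU-letterL-zero n (A [ i ]%= (x ▷L_))))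

actWord-zero : ∀ k → actWord k 0 ∼ scaleP (constTerm (wordP k)) (letterP 0)
actWord-zero [] G = trans (pair-letterL 0 G) (sym (trans (pair-scaleP (constTerm (wordP [])) (letterP 0) G)
  (trans (*-identityˡ (pair (letterP 0) G)) (pair-letterP 0 G))))
actWord-zero (c ∷ k) G = trans (cong (λ y → pair (lieP y) G) (actU-letterL-zero (length k) (lettersV (c ∷ k))))
  (sym (trans (pair-scaleP (constTerm (wordP (c ∷ k))) (letterP 0) G) (*-zeroˡ (pair (letterP 0) G))))

proposition4p19 : (k : List ℕ) →
    (actWord k 0 ≈ₚ scaleP (constTerm (wordP k)) (letterP 0))
    × ((s : ℕ) → s ≥ 1 → actWord k s ≈ₚ rhs k s)
proposition4p19 k =
  ∼⇒≈ {actWord k 0} {scaleP (constTerm (wordP k)) (letterP 0)} (actWord-zero k) ,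
  λ { zero () ; (suc s) _ → ∼⇒≈ {actWord k (suc s)} {rhs k (suc s)} (actWord-suc k s) }
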